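{- Let $n\geq 10$ be an integer with $n\not\equiv 0\pmod 4$. Then there is an earmarked word of length $n$.
   Context: Words are over $\Sigma_2=\{\mathtt{0},\mathtt{1}\}$. An overlap is a word $axaxa$ with $a$ a letter, $x$ possibly empty; a word is overlap-free if it has no overlap as a factor. A word $w\in\Sigma_2^*$ is earmarked if it is overlap-free, its length-4 prefix is in $\{\mathtt{0010},\mathtt{1101}\}$, and its length-4 suffix is $\mathtt{0100}$. -}

module Defs where

open import Data.Nat using (ℕ; _≥_; _%_)
open import Data.List using (List; []; _∷_; _++_; [_]; length; take; reverse)
open import Data.Product using (∃; ∃-syntax; _×_; _,_)
open import Data.Sum using (_⊎_)
open import Relation.Binary.PropositionalEquality using (_≡_)
open import Relation.Nullary using (¬_)

data Σ₂ : Set where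
  𝟎 𝟏 : Σ₂

Word : Set
Word = List Σ₂

Factor : Word → Word → Set
Factor u w = ∃[ p ] ∃[ s ] w ≡ p ++ u ++ s

IsOverlap : Word → Set
IsOverlap u = ∃[ a ] ∃[ x ] u ≡ a ∷ x ++ a ∷ x ++ [ a ]

OverlapFree : Word → Set
OverlapFree w = ∀ u → Factor u w → ¬ IsOverlap u

prefix4 : Word → Word
prefix4 w = take 4 w

suffix4 : Word → Word
suffix4 w = reverse (take 4 (reverse w))

Earmarked : Word → Set
Earmarked w =
  OverlapFree w
  × (prefix4 w ≡ 𝟎 ∷ 𝟎 ∷ 𝟏 ∷ 𝟎 ∷ [] ⊎ prefix4 w ≡ 𝟏 ∷ 𝟏 ∷ 𝟎 ∷ 𝟏 ∷ [])
  × suffix4 w ≡ 𝟎 ∷ 𝟏 ∷ 𝟎 ∷ 𝟎 ∷ []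

-- The words are built with the Thue–Morse morphism μ (0 ↦ 01, 1 ↦ 10).  An
-- overlap of period p in μ w contains a square of period p at an odd position;
-- unless p ∈ {1, 3} this square forces an overlap of w of period at most
-- p / 2, and squares of period 1 or 3 at even positions never occur in μ w.
-- So μ preserves overlap-freeness, and so does μ followed by complementing its
-- first (last) letter, provided the first (last) four letters of w avoid the
-- two patterns that would create an overlap of period 1 or 3 there.  Such a
-- step, followed by deleting at most three letters at each end, roughly
-- doubles the length, and the first and last four letters of the result are
-- determined by those of w.  A system of 19 states (a pair of such four-letter
-- borders and a length class mod 4), each with explicit words for small
-- lengths and a rule producing every larger length from a smaller length of
-- another state, is checked by computation.  Three states have earmarked
-- borders and supply all lengths n ≥ 45 with n ≢ 0 (mod 4); a table of words
-- covers 10 ≤ n < 45.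

module Submission where

open import Defs
open import Data.Bool.Base using (true; false; if_then_else_; T)
open import Data.Empty using (⊥)
open import Data.List.Base using (List; []; _∷_; _++_; [_]; length; take; reverse; applyUpTo)
open import Data.List.Properties using (length-++; reverse-++; length-applyUpTo; ≡-dec)
open import Data.List.Relation.Unary.Any using (Any; any?; satisfied)
open import Data.Nat.Base
open import Data.Nat.DivMod using (m≡m%n+[m/n]*n; m%n<n; /-monoˡ-≤)
open import Data.Nat.Induction using (<-rec)
open import Data.Nat.Properties
open import Data.Nat.Tactic.RingSolver using (solve-∀)
open import Data.Product.Base using (∃-syntax; _×_; _,_; proj₂)
open import Data.Product.Properties using () renaming (≡-dec to ×-≡-dec)
open import Data.Sum.Base using (_⊎_; inj₁; inj₂)
open import Data.Unit.Base using (⊤; tt)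
open import Function.Base using (_∘′_)
open import Relation.Binary.Definitions using (DecidableEquality)
open import Relation.Binary.PropositionalEquality hiding ([_])
open import Relation.Nullary.Decidable
  using (Dec; yes; no; map′; _×-dec_; _⊎-dec_; _→-dec_; ¬?; True; toWitness)
open import Relation.Nullary.Negation using (¬_; contradiction)

complement : Σ₂ → Σ₂
complement 𝟎 = 𝟏
complement 𝟏 = 𝟎

complement-involutive : ∀ x → complement (complement x) ≡ x
complement-involutive 𝟎 = refl
complement-involutive 𝟏 = refl

complement-≢ : ∀ x → x ≢ complement x
complement-≢ 𝟎 ()
complement-≢ 𝟏 ()

complement-swap : ∀ {x y} → complement x ≡ y → x ≡ complement y
complement-swap {x} refl = sym (complement-involutive x)

≡-via-complement : ∀ {x y z} → complement x ≡ z → y ≡ complement z → x ≡ y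
≡-via-complement {x} refl refl = sym (complement-involutive x)

no-alternation : ∀ {x y z} → x ≡ complement y → complement x ≡ z → y ≢ complement z
no-alternation {y = y} refl refl eq =
  complement-≢ y (trans eq (cong complement (complement-involutive y)))

_≟₂_ : DecidableEquality Σ₂
𝟎 ≟₂ 𝟎 = yes refl
𝟎 ≟₂ 𝟏 = no λ ()
𝟏 ≟₂ 𝟎 = no λ ()
𝟏 ≟₂ 𝟏 = yes refl

_≟w_ : DecidableEquality Word
_≟w_ = ≡-dec _≟₂_

double : ℕ → ℕ
double zero = zero
double (suc n) = suc (suc (double n))

double≡+ : ∀ n → double n ≡ n + n
double≡+ zero = refl
double≡+ (suc n) = cong suc (trans (cong suc (double≡+ n)) (sym (+-suc n n)))

double-+ : ∀ m n → double (m + n) ≡ double m + double n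
double-+ zero n = refl
double-+ (suc m) n = cong (suc ∘′ suc) (double-+ m n)

double-mono-≤ : ∀ {m n} → m ≤ n → double m ≤ double n
double-mono-≤ z≤n = z≤n
double-mono-≤ (s≤s m≤n) = s≤s (s≤s (double-mono-≤ m≤n))

double-cancel-< : ∀ {m n} → double m < double n → m < n
double-cancel-< {zero} {suc n} _ = s≤s z≤n
double-cancel-< {suc m} {suc n} (s≤s (s≤s lt)) = s≤s (double-cancel-< lt)

double≢odd : ∀ m n → double m ≢ suc (double n)
double≢odd zero n ()
double≢odd (suc zero) zero ()
double≢odd (suc (suc m)) zero ()
double≢odd (suc m) (suc n) eq = double≢odd m n (suc-injective (suc-injective eq))

half-≤ : ∀ {m n} → m + m ≤ n + n → m ≤ n
half-≤ le = ≮⇒≥ (λ n<m → <⇒≱ (+-mono-< n<m n<m) le)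

data ParityView : ℕ → Set where
  even : ∀ q → ParityView (double q)
  odd : ∀ q → ParityView (suc (double q))

parityView : ∀ n → ParityView n
parityView zero = even zero
parityView (suc n) with parityView n
... | even q = odd q
... | odd q = even (suc q)

halve : ∀ {u q} → u ≤ q → ∃[ h ] (q ≡ h + h + u ⊎ q ≡ h + h + suc u)
halve {u} {q} u≤q = split (parityView (q ∸ u)) (m∸n+n≡m u≤q)
  where
  split : ∀ {d} → ParityView d → d + u ≡ q → ∃[ h ] (q ≡ h + h + u ⊎ q ≡ h + h + suc u)
  split (even h) eq = h , inj₁ (trans (sym eq) (cong (_+ u) (double≡+ h)))
  split (odd h) eq =
    h , inj₂ (trans (sym eq) (trans (cong (λ n → suc n + u) (double≡+ h)) (sym (+-suc (h + h) u))))

Sequence : Set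
Sequence = ℕ → Σ₂

shift : ℕ → Sequence → Sequence
shift a f n = f (a + n)

-- f i … f (i + n + p - 1) has period p.  An overlap a x a x a with |a x| = p
-- starting at i is the case n = p + 1, a square of period p the case n = p.
Periodic : Sequence → (i p n : ℕ) → Set
Periodic f i p n = ∀ j → j < n → f (i + j) ≡ f (i + j + p)

Square Overlap : Sequence → ℕ → ℕ → Set
Square f i p = Periodic f i p p
Overlap f i p = Periodic f i p (suc p)

OverlapFreeBelow : Sequence → ℕ → Set
OverlapFreeBelow f L = ∀ i p → 0 < p → i + p + p < L → ¬ Overlap f i p

periodic-≤ : ∀ {f i p m n} → m ≤ n → Periodic f i p n → Periodic f i p m
periodic-≤ m≤n per j j<m = per j (<-≤-trans j<m m≤n)

periodic-suc : ∀ {f i p n} → Periodic f i p (suc n) → Periodic f (suc i) p n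
periodic-suc {f} {i} {p} per j j<n =
  subst (λ k → f k ≡ f (k + p)) (+-suc i j) (per (suc j) (s≤s j<n))

periodic-unshift : ∀ {f a i p n} → Periodic (shift a f) i p n → Periodic f (a + i) p n
periodic-unshift {f} {a} {i} {p} per j j<n =
  subst₂ (λ k l → f k ≡ f l) (sym (+-assoc a i j)) (assoc₃ a i j p) (per j j<n)
  where
  assoc₃ : ∀ a i j p → a + (i + j + p) ≡ a + i + j + p
  assoc₃ = solve-∀

overlap-evenSquare : ∀ {f i p} → Overlap f i p → ∃[ k ] Square f (double k) p
overlap-evenSquare {f} {i} ov with parityView i
... | even k = k , periodic-≤ {f} (n≤1+n _) ov
... | odd k = suc k , periodic-suc {f} ov

overlap-oddSquare : ∀ {f i p} → Overlap f i p → ∃[ m ] (double m ≤ i × Square f (suc (double m)) p)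
overlap-oddSquare {f} {i} ov with parityView i
... | even m = m , ≤-refl , periodic-suc {f} ov
... | odd m = m , n≤1+n _ , periodic-≤ {f} (n≤1+n _) ov

overlapFree-shift : ∀ {f L a L′} → OverlapFreeBelow f L → a + L′ ≤ L → OverlapFreeBelow (shift a f) L′
overlapFree-shift {f} {L} {a} {L′} free a+L′≤L i p 0<p bound ov =
  free (a + i) p 0<p (subst (_< L) (assoc₃ a i p) (<-≤-trans (+-monoʳ-< a bound) a+L′≤L))
       (periodic-unshift {f} {a} ov)
  where
  assoc₃ : ∀ a i p → a + (i + p + p) ≡ a + i + p + p
  assoc₃ = solve-∀

overlapFreeBelow-cong : ∀ {f g L} → (∀ k → k < L → f k ≡ g k)
                      → OverlapFreeBelow f L → OverlapFreeBelow g L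
overlapFreeBelow-cong {f} {g} {L} f≗g free i p 0<p bound ov = free i p 0<p bound ov′
  where
  ov′ : Overlap f i p
  ov′ j (s≤s j≤p) = trans (f≗g _ left<L) (trans (ov j (s≤s j≤p)) (sym (f≗g _ right<L)))
    where
    right<L : i + j + p < L
    right<L = ≤-<-trans (+-monoˡ-≤ p (+-monoʳ-≤ i j≤p)) bound
    left<L : i + j < L
    left<L = ≤-<-trans (m≤m+n (i + j) p) right<L

overlapFreeBelow? : ∀ f L → Dec (OverlapFreeBelow f L)
overlapFreeBelow? f L =
  map′ (λ free i p 0<p bound → free (below i p 0<p bound) (below′ i p 0<p bound) 0<p bound)
       (λ free {i} _ {p} _ → free i p)
       (allUpTo? (λ i → allUpTo? (λ p → 0 <? p →-dec (i + p + p <? L →-dec ¬? (periodic? i p))) L) L)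
  where
  periodic? : ∀ i p → Dec (Overlap f i p)
  periodic? i p =
    map′ (λ per j → per {j}) (λ per {j} → per j) (allUpTo? (λ j → f (i + j) ≟₂ f (i + j + p)) (suc p))
  below : ∀ i p → 0 < p → i + p + p < L → i < L
  below i p _ bound = ≤-<-trans (≤-trans (m≤m+n i p) (m≤m+n (i + p) p)) bound
  below′ : ∀ i p → 0 < p → i + p + p < L → p < L
  below′ i p _ bound = ≤-<-trans (≤-trans (m≤n+m p i) (m≤m+n (i + p) p)) bound

halve-bound : ∀ {m i Q P K} → double m ≤ i → Q + Q ≤ P → i + P + P < double K → m + Q + Q < K
halve-bound {m} {i} {Q} {P} {K} 2m≤i 2Q≤P bound = double-cancel-< (begin-strict
  double (m + Q + Q)              ≡⟨ trans (double-+ (m + Q) Q) (cong (_+ double Q) (double-+ m Q)) ⟩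
  double m + double Q + double Q  ≤⟨ +-mono-≤ (+-mono-≤ 2m≤i 2Q≤′P) 2Q≤′P ⟩
  i + P + P                       <⟨ bound ⟩
  double K                        ∎)
  where
  open ≤-Reasoning
  2Q≤′P : double Q ≤ P
  2Q≤′P = subst (_≤ P) (sym (double≡+ Q)) 2Q≤P

μ : Sequence → Sequence
μ g zero = g 0
μ g (suc zero) = complement (g 0)
μ g (suc (suc n)) = μ (shift 1 g) n

μ-double : ∀ g m → μ g (double m) ≡ g m
μ-double g zero = refl
μ-double g (suc m) = μ-double (shift 1 g) m

μ-suc-double : ∀ g m → μ g (suc (double m)) ≡ complement (g m)
μ-suc-double g zero = refl
μ-suc-double g (suc m) = μ-suc-double (shift 1 g) m

μ-shift : ∀ g m n → μ g (double m + n) ≡ μ (shift m g) n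
μ-shift g zero n = refl
μ-shift g (suc m) n = μ-shift (shift 1 g) m n

μ-local : ∀ {g h} M → (∀ k → k < M → g k ≡ h k) → ∀ n → n < double M → μ g n ≡ μ h n
μ-local (suc M) g≗h zero _ = g≗h 0 z<s
μ-local (suc M) g≗h (suc zero) _ = cong complement (g≗h 0 z<s)
μ-local (suc M) g≗h (suc (suc n)) (s≤s (s≤s n<2M)) =
  μ-local M (λ k k<M → g≗h (suc k) (s≤s k<M)) n n<2M

periodic-μ-shift : ∀ {g m i p n} → Periodic (μ g) (double m + i) p n → Periodic (μ (shift m g)) i p n
periodic-μ-shift {g} {m} {i} {p} per j j<n = begin
  μ (shift m g) (i + j)          ≡⟨ μ-shift g m (i + j) ⟨
  μ g (double m + (i + j))       ≡⟨ cong (μ g) (+-assoc (double m) i j) ⟨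
  μ g (double m + i + j)         ≡⟨ per j j<n ⟩
  μ g (double m + i + j + p)     ≡⟨ cong (μ g) (assoc₃ (double m) i j p) ⟩
  μ g (double m + (i + j + p))   ≡⟨ μ-shift g m (i + j + p) ⟩
  μ (shift m g) (i + j + p)      ∎
  where
  open ≡-Reasoning
  assoc₃ : ∀ a i j p → a + i + j + p ≡ a + (i + j + p)
  assoc₃ = solve-∀

ShortPeriod : ℕ → Set
ShortPeriod P = P ≡ 1 ⊎ P ≡ 3

-- A square of even period 2 Q at position 1 of μ h is the image of the overlap
-- h 0 … h (2 Q) without its first and last letter; an odd period P ≥ 5 already
-- forces h 0 = h 1 = h 2.
μ-square-reflect₀ : ∀ h P → 0 < P → Square (μ h) 1 P
                  → ShortPeriod P ⊎ ∃[ Q ] (0 < Q × Q + Q ≤ P × Overlap h 0 Q)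
μ-square-reflect₀ h P 0<P sq with parityView P
μ-square-reflect₀ h .(double Q) 0<P sq | even Q =
  inj₂ (Q , 0<Q , ≤-reflexive (sym (double≡+ Q)) , ov)
  where
  0<Q : 0 < Q
  0<Q = double-cancel-< 0<P
  ov : Overlap h 0 Q
  ov zero _ =
    ≡-via-complement (trans (sq 0 0<P) (μ-suc-double h Q)) (sym (complement-involutive (h Q)))
  ov (suc x) (s≤s x<Q) = begin
    h (suc x)                               ≡⟨ μ-double h (suc x) ⟨
    μ h (double (suc x))                    ≡⟨ sq (suc (double x)) (double-mono-≤ x<Q) ⟩
    μ h (suc (suc (double x + double Q)))   ≡⟨ cong (μ h ∘′ suc ∘′ suc) (double-+ x Q) ⟨
    μ h (double (suc x + Q))                ≡⟨ μ-double h (suc x + Q) ⟩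
    h (suc x + Q)                           ∎
    where open ≡-Reasoning
μ-square-reflect₀ h .(suc (double 0)) 0<P sq | odd zero = inj₁ (inj₁ refl)
μ-square-reflect₀ h .(suc (double 1)) 0<P sq | odd (suc zero) = inj₁ (inj₂ refl)
μ-square-reflect₀ h .(suc (double (suc (suc Q)))) 0<P sq | odd (suc (suc Q)) =
  inj₂ (1 , z<s , s≤s (s≤s z≤n) , cube)
  where
  ₀<P ₁<P ₂<P ₃<P : _ < suc (double (suc (suc Q)))
  ₀<P = s≤s z≤n
  ₁<P = s≤s (s≤s z≤n)
  ₂<P = s≤s (s≤s (s≤s z≤n))
  ₃<P = s≤s (s≤s (s≤s (s≤s z≤n)))
  cube : Overlap h 0 1
  cube zero _ = ≡-via-complement (trans (sq 0 ₀<P) (μ-double h (3 + Q)))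
                                 (trans (sq 1 ₁<P) (μ-suc-double h (3 + Q)))
  cube (suc zero) _ = ≡-via-complement (trans (sq 2 ₂<P) (μ-double h (4 + Q)))
                                       (trans (sq 3 ₃<P) (μ-suc-double h (4 + Q)))
  cube (suc (suc _)) (s≤s (s≤s ()))

μ-square-reflect : ∀ g m P → 0 < P → Square (μ g) (suc (double m)) P
                 → ShortPeriod P ⊎ ∃[ Q ] (0 < Q × Q + Q ≤ P × Overlap g m Q)
μ-square-reflect g m P 0<P sq
  with μ-square-reflect₀ (shift m g) P 0<P
         (periodic-μ-shift {g} {m} (subst (λ i → Square (μ g) i P) (+-comm 1 (double m)) sq))
... | inj₁ short = inj₁ short
... | inj₂ (Q , 0<Q , 2Q≤P , ov) =
  inj₂ (Q , 0<Q , 2Q≤P , subst (λ i → Overlap g i Q) (+-identityʳ m) (periodic-unshift {g} {m} ov))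

μ-no-short-evenSquare : ∀ {g k P} → ShortPeriod P → ¬ Square (μ g) (double k) P
μ-no-short-evenSquare {g} {k} {P} short sq = excluded short
  where
  h = shift k g
  sq₀ : Square (μ h) 0 P
  sq₀ = periodic-μ-shift {g} {k} (subst (λ i → Square (μ g) i P) (sym (+-identityʳ (double k))) sq)
  excluded : ShortPeriod P → ⊥
  excluded (inj₁ refl) = complement-≢ (h 0) (sq₀ 0 z<s)
  excluded (inj₂ refl) =
    no-alternation (sq₀ 0 z<s) (sq₀ 1 (s≤s (s≤s z≤n))) (sq₀ 2 (s≤s (s≤s (s≤s z≤n))))

μ-overlapFree : ∀ {g K} → OverlapFreeBelow g K → OverlapFreeBelow (μ g) (double K)
μ-overlapFree {g} free i P 0<P bound ov with overlap-oddSquare {μ g} {i} ov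
... | m , 2m≤i , sq with μ-square-reflect g m P 0<P sq
...   | inj₁ short =
  let k , sq′ = overlap-evenSquare {μ g} {i} ov in μ-no-short-evenSquare {g} {k} short sq′
...   | inj₂ (Q , 0<Q , 2Q≤P , ov′) = free m Q 0<Q (halve-bound 2m≤i 2Q≤P bound) ov′

flipAt : ℕ → Sequence → Sequence
flipAt z f n = if n ≡ᵇ z then complement (f n) else f n

flipAt-≢ : ∀ {z f n} → n ≢ z → flipAt z f n ≡ f n
flipAt-≢ {z} {f} {n} n≢z with n ≡ᵇ z in eq
... | true = contradiction (≡ᵇ⇒≡ n z (subst T (sym eq) _)) n≢z
... | false = refl

flipAt-cong : ∀ {z f f′ n} → f n ≡ f′ n → flipAt z f n ≡ flipAt z f′ n
flipAt-cong {z} {n = n} eq with n ≡ᵇ z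
... | true = cong complement eq
... | false = eq

flipAt-shift : ∀ x {z f f′ c} → f (x + c) ≡ f′ c → flipAt (x + z) f (x + c) ≡ flipAt z f′ c
flipAt-shift zero {z} {f} {f′} {c} eq = flipAt-cong {z} {f} {f′} {c} eq
flipAt-shift (suc x) {z} {f} {f′} {c} eq = flipAt-shift x {z} {shift 1 f} {f′} {c} eq

periodic-flipAt-beyond : ∀ {z f i p n} → i + n + p ≤ z → Periodic (flipAt z f) i p n → Periodic f i p n
periodic-flipAt-beyond {z} {f} {i} {p} bound per j j<n =
  trans (sym (flipAt-≢ {z} {f} {i + j} (<⇒≢ left<z)))
        (trans (per j j<n) (flipAt-≢ {z} {f} {i + j + p} (<⇒≢ right<z)))
  where
  right<z : i + j + p < z
  right<z = <-≤-trans (+-monoˡ-< p (+-monoʳ-< i j<n)) bound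
  left<z : i + j < z
  left<z = ≤-<-trans (m≤m+n (i + j) p) right<z

-- Complementing the first letter of μ h creates an overlap of period 1 or 3
-- unless these hold; FlipLastSafe is the mirror image for the last letter.
FlipFirstSafe : Sequence → Set
FlipFirstSafe h = h 0 ≡ h 1 × ¬ (h 2 ≡ complement (h 0) × h 3 ≡ complement (h 0))

FlipLastSafe : Sequence → Set
FlipLastSafe h = FlipFirstSafe (λ k → h (3 ∸ k))

flipFirstSafe? : ∀ h → Dec (FlipFirstSafe h)
flipFirstSafe? h = h 0 ≟₂ h 1 ×-dec ¬? (h 2 ≟₂ complement (h 0) ×-dec h 3 ≟₂ complement (h 0))

flipFirst-no-short-square : ∀ {g P} → FlipFirstSafe g → ShortPeriod P → ¬ Square (μ g) 1 P
flipFirst-no-short-square {g} (g₀≡g₁ , _) (inj₁ refl) sq =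
  complement-≢ (g 1) (trans (sym (sq 0 z<s)) (cong complement g₀≡g₁))
flipFirst-no-short-square {g} (g₀≡g₁ , safe) (inj₂ refl) sq =
  safe (sym (sq 0 z<s) , trans (sym (sq 2 (s≤s (s≤s (s≤s z≤n))))) (cong complement (sym g₀≡g₁)))

flipFirst-overlapFree : ∀ {g K} → OverlapFreeBelow g K → FlipFirstSafe g
                      → OverlapFreeBelow (flipAt 0 (μ g)) (double K)
flipFirst-overlapFree free safe (suc i) P 0<P bound ov = μ-overlapFree free (suc i) P 0<P bound ov
flipFirst-overlapFree {g} free safe zero P 0<P bound ov
  with μ-square-reflect g 0 P 0<P (periodic-suc {flipAt 0 (μ g)} {0} {P} ov)
... | inj₁ short = flipFirst-no-short-square safe short (periodic-suc {flipAt 0 (μ g)} {0} {P} ov)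
... | inj₂ (Q , 0<Q , 2Q≤P , ov′) = free 0 Q 0<Q (halve-bound {Q = Q} z≤n 2Q≤P bound) ov′

position-from-end : ∀ {i P} d c → i + P + P ≡ d + (c + P + P) → i ≡ d + c
position-from-end {i} {P} d c eq =
  +-cancelʳ-≡ (P + P) i (d + c) (trans (sym (+-assoc i P P)) (trans eq (reassoc d c P)))
  where
  reassoc : ∀ d c P → d + (c + P + P) ≡ d + c + (P + P)
  reassoc = solve-∀

flipLast-no-short-square : ∀ {g K′ i P} → FlipLastSafe (shift K′ g) → ShortPeriod P
                         → i + P + P ≡ double K′ + 7 → ¬ Square (μ g) i P
flipLast-no-short-square {g} {K′} {i} (h₃≡h₂ , _) (inj₁ refl) eq sq =
  complement-≢ (g (K′ + 2)) (sym (trans (sq′ 0 z<s) h₃≡h₂))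
  where
  sq′ : Square (μ (shift K′ g)) 5 1
  sq′ = periodic-μ-shift {g} {K′}
          (subst (λ i → Square (μ g) i 1) (position-from-end {i} {1} (double K′) 5 eq) sq)
flipLast-no-short-square {g} {K′} {i} (h₃≡h₂ , safe) (inj₂ refl) eq sq =
  safe ( trans (sq′ 1 (s≤s (s≤s z≤n))) (cong complement (sym h₃≡h₂))
       , trans (complement-swap (sq′ 0 z<s)) (cong complement (sym h₃≡h₂)))
  where
  sq′ : Square (μ (shift K′ g)) 1 3
  sq′ = periodic-μ-shift {g} {K′}
          (subst (λ i → Square (μ g) i 3) (position-from-end {i} {3} (double K′) 1 eq) sq)

-- An overlap through the complemented last letter ends there, hence starts at
-- an odd position, and without its last letter it is a square of μ g.
flipLast-overlapFree : ∀ {g K′} → OverlapFreeBelow g (4 + K′) → FlipLastSafe (shift K′ g)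
                     → OverlapFreeBelow (flipAt (double K′ + 7) (μ g)) (double (4 + K′))
flipLast-overlapFree {g} {K′} free safe i P 0<P bound ov
  with m≤n⇒m<n∨m≡n (subst (i + P + P ≤_) (+-comm 7 (double K′)) (≤-pred bound))
... | inj₁ before-last =
  μ-overlapFree free i P 0<P bound
    (periodic-flipAt-beyond {f = μ g} {i}
      (subst (_≤ double K′ + 7) (sym (cong (_+ P) (+-suc i P))) before-last) ov)
... | inj₂ ends-at-last with parityView i
...   | even m = double≢odd (m + P) (K′ + 3) (begin
  double (m + P)          ≡⟨ double-+ m P ⟩
  double m + double P     ≡⟨ cong (double m +_) (double≡+ P) ⟩
  double m + (P + P)      ≡⟨ +-assoc (double m) P P ⟨
  double m + P + P        ≡⟨ ends-at-last ⟩
  double K′ + 7           ≡⟨ trans (+-suc (double K′) 6) (cong suc (sym (double-+ K′ 3))) ⟩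
  suc (double (K′ + 3))   ∎)
  where open ≡-Reasoning
...   | odd m = odd-case (periodic-flipAt-beyond {f = μ g} {i} (≤-reflexive ends-at-last)
                        (periodic-≤ {flipAt (double K′ + 7) (μ g)} {i} (n≤1+n P) ov))
  where
  odd-case : Square (μ g) (suc (double m)) P → ⊥
  odd-case sq with μ-square-reflect g m P 0<P sq
  ... | inj₁ short = flipLast-no-short-square safe short ends-at-last sq
  ... | inj₂ (Q , 0<Q , 2Q≤P , ov′) = free m Q 0<Q (halve-bound (n≤1+n _) 2Q≤P bound) ov′

-- Junk value 𝟎 beyond the end of the word.
at : Word → Sequence
at [] _ = 𝟎
at (x ∷ w) zero = x
at (x ∷ w) (suc k) = at w k

at-applyUpTo : ∀ f {n k} → k < n → at (applyUpTo f n) k ≡ f k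
at-applyUpTo f {suc n} {zero} _ = refl
at-applyUpTo f {suc n} {suc k} (s≤s k<n) = at-applyUpTo (shift 1 f) k<n

at-++ʳ : ∀ u v k → at (u ++ v) (length u + k) ≡ at v k
at-++ʳ [] v k = refl
at-++ʳ (x ∷ u) v k = at-++ʳ u v k

at-++ˡ : ∀ u v {k} → k < length u → at (u ++ v) k ≡ at u k
at-++ˡ (x ∷ u) v {zero} _ = refl
at-++ˡ (x ∷ u) v {suc k} (s≤s k<u) = at-++ˡ u v k<u

at-++-∷ : ∀ u {a v v′ k} → k ≤ length u → at (u ++ a ∷ v) k ≡ at (u ++ a ∷ v′) k
at-++-∷ [] {k = zero} _ = refl
at-++-∷ (x ∷ u) {k = zero} _ = refl
at-++-∷ (x ∷ u) {k = suc k} (s≤s k≤u) = at-++-∷ u k≤u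

at-factor : ∀ p u s {k} → k < length u → at (p ++ u ++ s) (length p + k) ≡ at u k
at-factor p u s {k} k<u = trans (at-++ʳ p (u ++ s) k) (at-++ˡ u s k<u)

length-axaxa : ∀ (a : Σ₂) x
             → length (a ∷ x ++ a ∷ x ++ [ a ]) ≡ suc (length (a ∷ x) + length (a ∷ x))
length-axaxa a x = cong suc (begin
  length (x ++ a ∷ x ++ [ a ])     ≡⟨ length-++ x ⟩
  length x + suc (length (x ++ [ a ]))  ≡⟨ cong (λ n → length x + suc n) (length-++ x) ⟩
  length x + suc (length x + 1)    ≡⟨ arith (length x) ⟩
  suc (length x + suc (length x))  ∎)
  where
  open ≡-Reasoning
  arith : ∀ n → n + suc (n + 1) ≡ suc (n + suc n)
  arith = solve-∀

axaxa-overlap : ∀ (a : Σ₂) x → Overlap (at (a ∷ x ++ a ∷ x ++ [ a ])) 0 (length (a ∷ x))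
axaxa-overlap a x j (s≤s j≤P) =
  trans (at-++-∷ (a ∷ x) j≤P)
        (sym (trans (cong (at (a ∷ x ++ a ∷ x ++ [ a ])) (+-comm j (length (a ∷ x))))
                    (at-++ʳ (a ∷ x) (a ∷ x ++ [ a ]) j)))

overlapFree-at : ∀ {w} → OverlapFreeBelow (at w) (length w) → OverlapFree w
overlapFree-at free _ (p , s , refl) (a , x , refl) = free (length p) P z<s bound ov
  where
  u = a ∷ x ++ a ∷ x ++ [ a ]
  P = length (a ∷ x)
  bound : length p + P + P < length (p ++ u ++ s)
  bound = begin-strict
    length p + P + P                ≡⟨ +-assoc (length p) P P ⟩
    length p + (P + P)              <⟨ +-monoʳ-< (length p) (n<1+n (P + P)) ⟩
    length p + suc (P + P)          ≡⟨ cong (length p +_) (length-axaxa a x) ⟨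
    length p + length u             ≤⟨ +-monoʳ-≤ (length p) (m≤m+n (length u) (length s)) ⟩
    length p + (length u + length s) ≡⟨ trans (length-++ p) (cong (length p +_) (length-++ u)) ⟨
    length (p ++ u ++ s)            ∎
    where open ≤-Reasoning
  ov : Overlap (at (p ++ u ++ s)) (length p) P
  ov j j≤P = begin
    at (p ++ u ++ s) (length p + j)      ≡⟨ at-factor p u s (<-≤-trans j≤P u-long) ⟩
    at u j                               ≡⟨ axaxa-overlap a x j j≤P ⟩
    at u (j + P)                         ≡⟨ at-factor p u s (subst (j + P <_) u-length (+-monoˡ-< P j≤P)) ⟨
    at (p ++ u ++ s) (length p + (j + P)) ≡⟨ cong (at (p ++ u ++ s)) (+-assoc (length p) j P) ⟨
    at (p ++ u ++ s) (length p + j + P)  ∎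
    where
    open ≡-Reasoning
    u-length : suc (P + P) ≡ length u
    u-length = sym (length-axaxa a x)
    u-long : suc P ≤ length u
    u-long = subst (suc P ≤_) u-length (s≤s (m≤m+n P P))

overlapFree-applyUpTo : ∀ {f n} → OverlapFreeBelow f n → OverlapFree (applyUpTo f n)
overlapFree-applyUpTo {f} {n} free =
  overlapFree-at (subst (OverlapFreeBelow (at (applyUpTo f n))) (sym (length-applyUpTo f n))
                        (overlapFreeBelow-cong (λ k k<n → sym (at-applyUpTo f k<n)) free))

applyUpTo-+ : ∀ f m n → applyUpTo f (m + n) ≡ applyUpTo f m ++ applyUpTo (shift m f) n
applyUpTo-+ f zero n = refl
applyUpTo-+ f (suc m) n = cong (f 0 ∷_) (applyUpTo-+ (shift 1 f) m n)

suffix4-applyUpTo : ∀ g L → suffix4 (applyUpTo g (4 + L)) ≡ applyUpTo (shift L g) 4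
suffix4-applyUpTo g L = begin
  suffix4 (applyUpTo g (4 + L))
    ≡⟨ cong (suffix4 ∘′ applyUpTo g) (+-comm 4 L) ⟩
  suffix4 (applyUpTo g (L + 4))
    ≡⟨ cong suffix4 (applyUpTo-+ g L 4) ⟩
  suffix4 (applyUpTo g L ++ applyUpTo (shift L g) 4)
    ≡⟨ cong (reverse ∘′ take 4) (reverse-++ (applyUpTo g L) _) ⟩
  applyUpTo (shift L g) 4
    ∎
  where open ≡-Reasoning

-- A sequence g with a length L stands for the word g 0 … g (L + 3); its border
-- is the pair (prefix of length 4 , suffix of length 4).
Border : Set
Border = Word × Word

HasBorder : Sequence → ℕ → Border → Set
HasBorder g L (u , v) = applyUpTo g 4 ≡ u × applyUpTo (shift L g) 4 ≡ v

Realizes : Sequence → ℕ → Border → Set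
Realizes g L β = OverlapFreeBelow g (4 + L) × HasBorder g L β

realizes? : ∀ g L β → Dec (Realizes g L β)
realizes? g L (u , v) =
  overlapFreeBelow? g (4 + L) ×-dec (applyUpTo g 4 ≟w u ×-dec applyUpTo (shift L g) 4 ≟w v)

hasBorder-prefix : ∀ {g L u v} → HasBorder g L (u , v) → ∀ k → k < 4 → at u k ≡ g k
hasBorder-prefix {g} (refl , _) k k<4 = at-applyUpTo g k<4

hasBorder-suffix : ∀ {g L u v} → HasBorder g L (u , v) → ∀ k → k < 4 → at v k ≡ g (L + k)
hasBorder-suffix {g} {L} (_ , refl) k k<4 = at-applyUpTo (shift L g) k<4

applyUpTo-cong : ∀ {f g : Sequence} n → (∀ k → k < n → f k ≡ g k) → applyUpTo f n ≡ applyUpTo g n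
applyUpTo-cong zero f≗g = refl
applyUpTo-cong (suc n) f≗g =
  cong₂ _∷_ (f≗g 0 z<s) (applyUpTo-cong n (λ k k<n → f≗g (suc k) (s≤s k<n)))

flipFirstSafe-cong : ∀ {f g} → (∀ k → k < 4 → f k ≡ g k) → FlipFirstSafe f → FlipFirstSafe g
flipFirstSafe-cong {f} {g} f≗g (f₀≡f₁ , safe) =
  trans (sym e₀) (trans f₀≡f₁ e₁) ,
  λ (g₂ , g₃) → safe ( trans e₂ (trans g₂ (cong complement (sym e₀)))
                     , trans e₃ (trans g₃ (cong complement (sym e₀))))
  where
  e₀ = f≗g 0 (s≤s z≤n)
  e₁ = f≗g 1 (s≤s (s≤s z≤n))
  e₂ = f≗g 2 (s≤s (s≤s (s≤s z≤n)))
  e₃ = f≗g 3 (s≤s (s≤s (s≤s (s≤s z≤n))))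

flipLastSafe-cong : ∀ {f g} → (∀ k → k < 4 → f k ≡ g k) → FlipLastSafe f → FlipLastSafe g
flipLastSafe-cong f≗g = flipFirstSafe-cong (λ k _ → f≗g (3 ∸ k) (s≤s (m∸n≤m 3 k)))

data Operation : Set where
  morph flipFirst flipLast : Operation

-- Applied to a word of length 4 + K; flipLast complements the last letter.
apply : Operation → ℕ → Sequence → Sequence
apply morph K g = μ g
apply flipFirst K g = flipAt 0 (μ g)
apply flipLast K g = flipAt (double K + 7) (μ g)

Admissible : Operation → Border → Set
Admissible morph β = ⊤
Admissible flipFirst (u , v) = FlipFirstSafe (at u)
Admissible flipLast (u , v) = FlipLastSafe (at v)

admissible? : ∀ op β → Dec (Admissible op β)
admissible? morph β = yes tt
admissible? flipFirst (u , v) = flipFirstSafe? (at u)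
admissible? flipLast (u , v) = flipFirstSafe? (λ k → at v (3 ∸ k))

apply-overlapFree : ∀ op {g K β} → Realizes g K β → Admissible op β
                  → OverlapFreeBelow (apply op K g) (double (4 + K))
apply-overlapFree morph (free , _) _ = μ-overlapFree free
apply-overlapFree flipFirst {g} {K} (free , border) safe =
  flipFirst-overlapFree free (flipFirstSafe-cong (hasBorder-prefix {g} {K} border) safe)
apply-overlapFree flipLast {g} {K} (free , border) safe =
  flipLast-overlapFree free (flipLastSafe-cong (hasBorder-suffix {g} {K} border) safe)

-- The first and the last seven letters of apply op K g, as functions of the
-- first and the last four letters of g.
prefixImage suffixImage : Operation → Sequence → Sequence
prefixImage morph h = μ h
prefixImage flipFirst h = flipAt 0 (μ h)
prefixImage flipLast h = μ h
suffixImage morph h = μ h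
suffixImage flipFirst h = μ h
suffixImage flipLast h = flipAt 7 (μ h)

apply-prefix : ∀ op {g h K n} → (∀ k → k < 4 → h k ≡ g k) → n < 7
             → apply op K g n ≡ prefixImage op h n
apply-prefix morph h≗g n<7 = sym (μ-local 4 h≗g _ (<-trans n<7 (n<1+n 7)))
apply-prefix flipFirst {g} {h} {n = n} h≗g n<7 =
  flipAt-cong {0} {μ g} {μ h} {n} (sym (μ-local 4 h≗g _ (<-trans n<7 (n<1+n 7))))
apply-prefix flipLast {g} {K = K} h≗g n<7 =
  trans (flipAt-≢ {double K + 7} {μ g} (<⇒≢ (<-≤-trans n<7 (m≤n+m 7 (double K)))))
        (sym (μ-local 4 h≗g _ (<-trans n<7 (n<1+n 7))))

μ-suffix : ∀ {g h} K {c} → (∀ k → k < 4 → h k ≡ g (K + k)) → c < 8 → μ g (double K + c) ≡ μ h c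
μ-suffix {g} K {c} h≗g c<8 = trans (μ-shift g K c) (sym (μ-local 4 h≗g c c<8))

apply-suffix : ∀ op {g h K c} → (∀ k → k < 4 → h k ≡ g (K + k)) → 0 < c → c < 8
             → apply op K g (double K + c) ≡ suffixImage op h c
apply-suffix morph {K = K} h≗g 0<c c<8 = μ-suffix K h≗g c<8
apply-suffix flipFirst {g} {K = K} {c} h≗g 0<c c<8 =
  trans (flipAt-≢ {0} {μ g} (>⇒≢ (<-≤-trans 0<c (m≤n+m c (double K))))) (μ-suffix K h≗g c<8)
apply-suffix flipLast {g} {h} {K} {c} h≗g 0<c c<8 =
  flipAt-shift (double K) {7} {μ g} {μ h} {c} (μ-suffix K h≗g c<8)

-- The border after dropping a letters in front and b letters at the back.
childBorder : Operation → ℕ → ℕ → Border → Border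
childBorder op a b (u , v) =
  applyUpTo (shift a (prefixImage op (at u))) 4 , applyUpTo (shift (4 ∸ b) (suffixImage op (at v))) 4

trimmed-index : ∀ {a L b d} k → b ≤ 4 → a + L + b ≡ d + 4 → a + (L + k) ≡ d + (4 ∸ b + k)
trimmed-index {a} {L} {b} {d} k b≤4 eq = begin
  a + (L + k)      ≡⟨ +-assoc a L k ⟨
  a + L + k        ≡⟨ cong (_+ k) (+-cancelʳ-≡ b (a + L) (d + (4 ∸ b)) (begin
    a + L + b          ≡⟨ eq ⟩
    d + 4              ≡⟨ cong (d +_) (m∸n+n≡m b≤4) ⟨
    d + (4 ∸ b + b)    ≡⟨ +-assoc d (4 ∸ b) b ⟨
    d + (4 ∸ b) + b    ∎)) ⟩
  d + (4 ∸ b) + k  ≡⟨ +-assoc d (4 ∸ b) k ⟩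
  d + (4 ∸ b + k)  ∎
  where open ≡-Reasoning

hasBorder-child : ∀ op {g K β a b L} → HasBorder g K β → a ≤ 3 → b ≤ 3 → a + L + b ≡ double K + 4
                → HasBorder (shift a (apply op K g)) L (childBorder op a b β)
hasBorder-child op {g} {K} {u , v} {a} {b} {L} border a≤3 b≤3 eq =
  applyUpTo-cong 4 (λ k k<4 →
    apply-prefix op {g} {at u} {K} {a + k} (hasBorder-prefix {g} {K} border) (+-mono-≤-< a≤3 k<4)) ,
  applyUpTo-cong 4 (λ k k<4 →
    trans (cong (apply op K g) (trimmed-index {a} {L} {b} {double K} k (m≤n⇒m≤1+n b≤3) eq))
          (apply-suffix op {g} {at v} {K} {4 ∸ b + k} (hasBorder-suffix {g} {K} border)
                        (<-≤-trans (m<n⇒0<n∸m (s≤s b≤3)) (m≤m+n (4 ∸ b) k))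
                        (+-mono-≤-< (m∸n≤m 4 b) k<4)))

realizes-child : ∀ op {g K β a b L} → Realizes g K β → Admissible op β → a ≤ 3 → b ≤ 3
               → a + L + b ≡ double K + 4 → Realizes (shift a (apply op K g)) L (childBorder op a b β)
realizes-child op {g} {K} {β} {a} {b} {L} r admissible a≤3 b≤3 eq =
  overlapFree-shift {apply op K g} {a = a} (apply-overlapFree op {g} {K} {β} r admissible) fits ,
  hasBorder-child op {g} {K} {β} {a} {b} {L} (proj₂ r) a≤3 b≤3 eq
  where
  fits : a + (4 + L) ≤ double (4 + K)
  fits = begin
    a + (4 + L)        ≤⟨ m≤m+n (a + (4 + L)) b ⟩
    a + (4 + L) + b    ≡⟨ reassoc a L b ⟩
    4 + (a + L + b)    ≡⟨ cong (4 +_) (trans eq (+-comm (double K) 4)) ⟩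
    double (4 + K)     ∎
    where
    open ≤-Reasoning
    reassoc : ∀ a L b → a + (4 + L) + b ≡ 4 + (a + L + b)
    reassoc = solve-∀

parent-large : ∀ {q₀ qb h u v} → qb ≤ h + h + u → q₀ + q₀ + u ≤ qb + v + v → q₀ ≤ h + v
parent-large {q₀} {qb} {h} {u} {v} qb≤q le = half-≤ (+-cancelʳ-≤ u _ _ (begin
  q₀ + q₀ + u          ≤⟨ le ⟩
  qb + v + v           ≤⟨ +-monoˡ-≤ v (+-monoˡ-≤ v qb≤q) ⟩
  h + h + u + v + v    ≡⟨ arith h u v ⟩
  h + v + (h + v) + u  ∎))
  where
  open ≤-Reasoning
  arith : ∀ h u v → h + h + u + v + v ≡ h + v + (h + v) + u
  arith = solve-∀

parent-smaller : ∀ {qb h u v} → qb ≤ h + h + u → v + v + 2 ≤ qb + u → h + v < h + h + u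
parent-smaller {qb} {h} {u} {v} qb≤q le = begin
  suc (h + v)    ≡⟨ +-suc h v ⟨
  h + suc v      ≤⟨ +-monoʳ-≤ h (half-≤ (begin
    suc v + suc v    ≡⟨ arith₁ v ⟩
    v + v + 2        ≤⟨ le ⟩
    qb + u           ≤⟨ +-monoˡ-≤ u qb≤q ⟩
    h + h + u + u    ≡⟨ arith₂ h u ⟩
    h + u + (h + u)  ∎)) ⟩
  h + (h + u)    ≡⟨ +-assoc h h u ⟨
  h + h + u      ∎
  where
  open ≤-Reasoning
  arith₁ : ∀ v → suc v + suc v ≡ v + v + 2
  arith₁ = solve-∀
  arith₂ : ∀ h u → h + h + u + u ≡ h + u + (h + u)
  arith₂ = solve-∀

rule-length : ∀ {u r a b v r′} h → 4 * u + r + a + b ≡ 8 * v + 2 * r′ + 4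
            → a + (4 * (h + h + u) + r) + b ≡ double (4 * (h + v) + r′) + 4
rule-length {u} {r} {a} {b} {v} {r′} h eq = begin
  a + (4 * (h + h + u) + r) + b              ≡⟨ arith₁ h u r a b ⟩
  8 * h + (4 * u + r + a + b)                ≡⟨ cong (8 * h +_) eq ⟩
  8 * h + (8 * v + 2 * r′ + 4)               ≡⟨ arith₂ h v r′ ⟩
  4 * (h + v) + r′ + (4 * (h + v) + r′) + 4  ≡⟨ cong (_+ 4) (double≡+ (4 * (h + v) + r′)) ⟨
  double (4 * (h + v) + r′) + 4              ∎
  where
  open ≡-Reasoning
  arith₁ : ∀ h u r a b → a + (4 * (h + h + u) + r) + b ≡ 8 * h + (4 * u + r + a + b)
  arith₁ = solve-∀
  arith₂ : ∀ h v r′ → 8 * h + (8 * v + 2 * r′ + 4) ≡ 4 * (h + v) + r′ + (4 * (h + v) + r′) + 4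
  arith₂ = solve-∀

data State : Set where
  S0 S1 S2 S3 S4 S5 S6 S7 S8 S9 S10 S11 S12 S13 S14 S15 S16 S17 S18 : State

-- The words of a state s, for q = h + h + u, are obtained from those of the
-- state `parent` for q = h + offset by `operation`, followed by dropping
-- `front` letters in front and `back` letters at the back.
record Rule : Set where
  constructor rule
  field
    parent : State
    operation : Operation
    front back offset : ℕ

-- A state stands for overlap-free words of border `border` and length
-- 4 + (4 q + residue) for all q ≥ firstBase: explicit ones (baseWord) below
-- firstRule, and from there on built by evenRule or oddRule according to the
-- parity of q - ruleOffset.
record Spec : Set where
  constructor spec
  field
    border : Border
    residue firstBase firstRule ruleOffset : ℕ
    evenRule oddRule : Rule

specOf : State → Spec
specOf S0 = spec (𝟎 ∷ 𝟎 ∷ 𝟏 ∷ 𝟎 ∷ [] , 𝟎 ∷ 𝟏 ∷ 𝟎 ∷ 𝟎 ∷ []) 2 4 5 0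
  (rule S7 morph 3 1 0) (rule S8 morph 3 1 0)
specOf S1 = spec (𝟎 ∷ 𝟎 ∷ 𝟏 ∷ 𝟎 ∷ [] , 𝟎 ∷ 𝟏 ∷ 𝟎 ∷ 𝟎 ∷ []) 3 6 7 0
  (rule S14 flipLast 1 0 0) (rule S6 flipLast 3 0 0)
specOf S2 = spec (𝟎 ∷ 𝟎 ∷ 𝟏 ∷ 𝟎 ∷ [] , 𝟎 ∷ 𝟏 ∷ 𝟏 ∷ 𝟎 ∷ []) 0 3 6 2
  (rule S16 flipFirst 0 2 0) (rule S18 flipFirst 0 2 1)
specOf S3 = spec (𝟎 ∷ 𝟎 ∷ 𝟏 ∷ 𝟎 ∷ [] , 𝟏 ∷ 𝟎 ∷ 𝟎 ∷ 𝟏 ∷ []) 1 3 7 0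
  (rule S14 morph 1 2 0) (rule S6 morph 3 2 0)
specOf S4 = spec (𝟎 ∷ 𝟎 ∷ 𝟏 ∷ 𝟏 ∷ [] , 𝟎 ∷ 𝟎 ∷ 𝟏 ∷ 𝟏 ∷ []) 2 1 2 0
  (rule S15 morph 1 1 0) (rule S9 morph 3 1 0)
specOf S5 = spec (𝟎 ∷ 𝟎 ∷ 𝟏 ∷ 𝟏 ∷ [] , 𝟎 ∷ 𝟏 ∷ 𝟏 ∷ 𝟎 ∷ []) 1 2 5 0
  (rule S18 morph 3 2 0) (rule S16 morph 3 2 0)
specOf S6 = spec (𝟎 ∷ 𝟏 ∷ 𝟎 ∷ 𝟎 ∷ [] , 𝟎 ∷ 𝟏 ∷ 𝟎 ∷ 𝟎 ∷ []) 3 3 10 0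
  (rule S11 flipLast 3 0 0) (rule S12 flipLast 3 0 0)
specOf S7 = spec (𝟎 ∷ 𝟏 ∷ 𝟎 ∷ 𝟎 ∷ [] , 𝟎 ∷ 𝟏 ∷ 𝟏 ∷ 𝟎 ∷ []) 1 1 3 0
  (rule S10 morph 3 2 0) (rule S13 morph 3 0 0)
specOf S8 = spec (𝟎 ∷ 𝟏 ∷ 𝟎 ∷ 𝟎 ∷ [] , 𝟎 ∷ 𝟏 ∷ 𝟏 ∷ 𝟎 ∷ []) 3 2 5 0
  (rule S18 morph 1 2 0) (rule S16 morph 1 2 0)
specOf S9 = spec (𝟎 ∷ 𝟏 ∷ 𝟎 ∷ 𝟏 ∷ [] , 𝟏 ∷ 𝟏 ∷ 𝟎 ∷ 𝟏 ∷ []) 3 0 4 0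
  (rule S5 morph 0 3 0) (rule S4 morph 0 1 0)
specOf S10 = spec (𝟎 ∷ 𝟏 ∷ 𝟏 ∷ 𝟎 ∷ [] , 𝟎 ∷ 𝟎 ∷ 𝟏 ∷ 𝟎 ∷ []) 1 1 9 2
  (rule S12 flipLast 0 1 0) (rule S0 morph 2 1 1)
specOf S11 = spec (𝟎 ∷ 𝟏 ∷ 𝟏 ∷ 𝟎 ∷ [] , 𝟎 ∷ 𝟏 ∷ 𝟎 ∷ 𝟎 ∷ []) 1 5 6 0
  (rule S2 morph 2 1 0) (rule S7 morph 0 1 0)
specOf S12 = spec (𝟎 ∷ 𝟏 ∷ 𝟏 ∷ 𝟎 ∷ [] , 𝟎 ∷ 𝟏 ∷ 𝟎 ∷ 𝟎 ∷ []) 3 0 4 0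
  (rule S5 morph 2 1 0) (rule S9 morph 0 3 0)
specOf S13 = spec (𝟎 ∷ 𝟏 ∷ 𝟏 ∷ 𝟎 ∷ [] , 𝟎 ∷ 𝟏 ∷ 𝟎 ∷ 𝟏 ∷ []) 2 1 9 2
  (rule S12 morph 0 0 0) (rule S0 morph 2 0 1)
specOf S14 = spec (𝟏 ∷ 𝟎 ∷ 𝟎 ∷ 𝟏 ∷ [] , 𝟎 ∷ 𝟏 ∷ 𝟎 ∷ 𝟎 ∷ []) 0 2 8 2
  (rule S6 flipLast 2 0 0) (rule S14 flipLast 0 0 1)
specOf S15 = spec (𝟏 ∷ 𝟎 ∷ 𝟏 ∷ 𝟎 ∷ [] , 𝟎 ∷ 𝟏 ∷ 𝟎 ∷ 𝟏 ∷ []) 0 1 11 2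
  (rule S12 morph 2 0 0) (rule S11 morph 2 0 1)
specOf S16 = spec (𝟏 ∷ 𝟏 ∷ 𝟎 ∷ 𝟏 ∷ [] , 𝟎 ∷ 𝟎 ∷ 𝟏 ∷ 𝟎 ∷ []) 3 2 9 0
  (rule S3 flipFirst 0 3 0) (rule S0 flipFirst 0 1 0)
specOf S17 = spec (𝟏 ∷ 𝟏 ∷ 𝟎 ∷ 𝟏 ∷ [] , 𝟎 ∷ 𝟏 ∷ 𝟎 ∷ 𝟎 ∷ []) 1 10 11 2
  (rule S12 flipLast 1 0 0) (rule S11 flipLast 1 0 1)
specOf S18 = spec (𝟏 ∷ 𝟏 ∷ 𝟎 ∷ 𝟏 ∷ [] , 𝟏 ∷ 𝟎 ∷ 𝟏 ∷ 𝟎 ∷ []) 1 2 4 0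
  (rule S5 morph 3 2 0) (rule S4 morph 3 0 0)

baseWord : State → ℕ → Word
baseWord S0 4 = 𝟎 ∷ 𝟎 ∷ 𝟏 ∷ 𝟎 ∷ 𝟏 ∷ 𝟏 ∷ 𝟎 ∷ 𝟎 ∷ 𝟏 ∷ 𝟏 ∷ 𝟎 ∷ 𝟏 ∷ 𝟎 ∷ 𝟎 ∷ 𝟏 ∷ 𝟎 ∷ 𝟏 ∷ 𝟏 ∷ 𝟎 ∷ 𝟏 ∷ 𝟎 ∷ 𝟎 ∷ []
baseWord S1 6 = 𝟎 ∷ 𝟎 ∷ 𝟏 ∷ 𝟎 ∷ 𝟎 ∷ 𝟏 ∷ 𝟏 ∷ 𝟎 ∷ 𝟏 ∷ 𝟎 ∷ 𝟎 ∷ 𝟏 ∷ 𝟎 ∷ 𝟏 ∷ 𝟏 ∷ 𝟎 ∷ 𝟏 ∷ 𝟎 ∷ 𝟎 ∷ 𝟏 ∷ 𝟏 ∷ 𝟎 ∷ 𝟎 ∷ 𝟏 ∷ 𝟎 ∷ 𝟏 ∷ 𝟏 ∷ 𝟎 ∷ 𝟏 ∷ 𝟎 ∷ 𝟎 ∷ []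
baseWord S2 3 = 𝟎 ∷ 𝟎 ∷ 𝟏 ∷ 𝟎 ∷ 𝟎 ∷ 𝟏 ∷ 𝟏 ∷ 𝟎 ∷ 𝟏 ∷ 𝟎 ∷ 𝟎 ∷ 𝟏 ∷ 𝟎 ∷ 𝟏 ∷ 𝟏 ∷ 𝟎 ∷ []
baseWord S2 4 = 𝟎 ∷ 𝟎 ∷ 𝟏 ∷ 𝟎 ∷ 𝟎 ∷ 𝟏 ∷ 𝟏 ∷ 𝟎 ∷ 𝟎 ∷ 𝟏 ∷ 𝟎 ∷ 𝟏 ∷ 𝟏 ∷ 𝟎 ∷ 𝟏 ∷ 𝟎 ∷ 𝟎 ∷ 𝟏 ∷ 𝟏 ∷ 𝟎 ∷ []
baseWord S2 5 = 𝟎 ∷ 𝟎 ∷ 𝟏 ∷ 𝟎 ∷ 𝟎 ∷ 𝟏 ∷ 𝟏 ∷ 𝟎 ∷ 𝟎 ∷ 𝟏 ∷ 𝟎 ∷ 𝟏 ∷ 𝟏 ∷ 𝟎 ∷ 𝟎 ∷ 𝟏 ∷ 𝟏 ∷ 𝟎 ∷ 𝟏 ∷ 𝟎 ∷ 𝟎 ∷ 𝟏 ∷ 𝟏 ∷ 𝟎 ∷ []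
baseWord S3 3 = 𝟎 ∷ 𝟎 ∷ 𝟏 ∷ 𝟎 ∷ 𝟏 ∷ 𝟏 ∷ 𝟎 ∷ 𝟏 ∷ 𝟎 ∷ 𝟎 ∷ 𝟏 ∷ 𝟎 ∷ 𝟏 ∷ 𝟏 ∷ 𝟎 ∷ 𝟎 ∷ 𝟏 ∷ []
baseWord S3 4 = 𝟎 ∷ 𝟎 ∷ 𝟏 ∷ 𝟎 ∷ 𝟏 ∷ 𝟏 ∷ 𝟎 ∷ 𝟎 ∷ 𝟏 ∷ 𝟏 ∷ 𝟎 ∷ 𝟏 ∷ 𝟎 ∷ 𝟎 ∷ 𝟏 ∷ 𝟎 ∷ 𝟏 ∷ 𝟏 ∷ 𝟎 ∷ 𝟎 ∷ 𝟏 ∷ []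
baseWord S3 5 = 𝟎 ∷ 𝟎 ∷ 𝟏 ∷ 𝟎 ∷ 𝟏 ∷ 𝟏 ∷ 𝟎 ∷ 𝟎 ∷ 𝟏 ∷ 𝟏 ∷ 𝟎 ∷ 𝟏 ∷ 𝟎 ∷ 𝟎 ∷ 𝟏 ∷ 𝟏 ∷ 𝟎 ∷ 𝟎 ∷ 𝟏 ∷ 𝟎 ∷ 𝟏 ∷ 𝟏 ∷ 𝟎 ∷ 𝟎 ∷ 𝟏 ∷ []
baseWord S3 6 = 𝟎 ∷ 𝟎 ∷ 𝟏 ∷ 𝟎 ∷ 𝟏 ∷ 𝟏 ∷ 𝟎 ∷ 𝟏 ∷ 𝟎 ∷ 𝟎 ∷ 𝟏 ∷ 𝟏 ∷ 𝟎 ∷ 𝟎 ∷ 𝟏 ∷ 𝟎 ∷ 𝟏 ∷ 𝟏 ∷ 𝟎 ∷ 𝟏 ∷ 𝟎 ∷ 𝟎 ∷ 𝟏 ∷ 𝟎 ∷ 𝟏 ∷ 𝟏 ∷ 𝟎 ∷ 𝟎 ∷ 𝟏 ∷ []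
baseWord S4 1 = 𝟎 ∷ 𝟎 ∷ 𝟏 ∷ 𝟏 ∷ 𝟎 ∷ 𝟏 ∷ 𝟎 ∷ 𝟎 ∷ 𝟏 ∷ 𝟏 ∷ []
baseWord S5 2 = 𝟎 ∷ 𝟎 ∷ 𝟏 ∷ 𝟏 ∷ 𝟎 ∷ 𝟏 ∷ 𝟎 ∷ 𝟎 ∷ 𝟏 ∷ 𝟎 ∷ 𝟏 ∷ 𝟏 ∷ 𝟎 ∷ []
baseWord S5 3 = 𝟎 ∷ 𝟎 ∷ 𝟏 ∷ 𝟏 ∷ 𝟎 ∷ 𝟎 ∷ 𝟏 ∷ 𝟎 ∷ 𝟏 ∷ 𝟏 ∷ 𝟎 ∷ 𝟏 ∷ 𝟎 ∷ 𝟎 ∷ 𝟏 ∷ 𝟏 ∷ 𝟎 ∷ []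
baseWord S5 4 = 𝟎 ∷ 𝟎 ∷ 𝟏 ∷ 𝟏 ∷ 𝟎 ∷ 𝟎 ∷ 𝟏 ∷ 𝟎 ∷ 𝟏 ∷ 𝟏 ∷ 𝟎 ∷ 𝟎 ∷ 𝟏 ∷ 𝟏 ∷ 𝟎 ∷ 𝟏 ∷ 𝟎 ∷ 𝟎 ∷ 𝟏 ∷ 𝟏 ∷ 𝟎 ∷ []
baseWord S6 3 = 𝟎 ∷ 𝟏 ∷ 𝟎 ∷ 𝟎 ∷ 𝟏 ∷ 𝟎 ∷ 𝟏 ∷ 𝟏 ∷ 𝟎 ∷ 𝟏 ∷ 𝟎 ∷ 𝟎 ∷ 𝟏 ∷ 𝟏 ∷ 𝟎 ∷ 𝟎 ∷ 𝟏 ∷ 𝟎 ∷ 𝟎 ∷ []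
baseWord S6 4 = 𝟎 ∷ 𝟏 ∷ 𝟎 ∷ 𝟎 ∷ 𝟏 ∷ 𝟎 ∷ 𝟏 ∷ 𝟏 ∷ 𝟎 ∷ 𝟎 ∷ 𝟏 ∷ 𝟏 ∷ 𝟎 ∷ 𝟏 ∷ 𝟎 ∷ 𝟎 ∷ 𝟏 ∷ 𝟏 ∷ 𝟎 ∷ 𝟎 ∷ 𝟏 ∷ 𝟎 ∷ 𝟎 ∷ []
baseWord S6 5 = 𝟎 ∷ 𝟏 ∷ 𝟎 ∷ 𝟎 ∷ 𝟏 ∷ 𝟏 ∷ 𝟎 ∷ 𝟎 ∷ 𝟏 ∷ 𝟎 ∷ 𝟏 ∷ 𝟏 ∷ 𝟎 ∷ 𝟎 ∷ 𝟏 ∷ 𝟏 ∷ 𝟎 ∷ 𝟏 ∷ 𝟎 ∷ 𝟎 ∷ 𝟏 ∷ 𝟏 ∷ 𝟎 ∷ 𝟎 ∷ 𝟏 ∷ 𝟎 ∷ 𝟎 ∷ []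
baseWord S6 6 = 𝟎 ∷ 𝟏 ∷ 𝟎 ∷ 𝟎 ∷ 𝟏 ∷ 𝟎 ∷ 𝟏 ∷ 𝟏 ∷ 𝟎 ∷ 𝟎 ∷ 𝟏 ∷ 𝟏 ∷ 𝟎 ∷ 𝟏 ∷ 𝟎 ∷ 𝟎 ∷ 𝟏 ∷ 𝟎 ∷ 𝟏 ∷ 𝟏 ∷ 𝟎 ∷ 𝟏 ∷ 𝟎 ∷ 𝟎 ∷ 𝟏 ∷ 𝟏 ∷ 𝟎 ∷ 𝟎 ∷ 𝟏 ∷ 𝟎 ∷ 𝟎 ∷ []
baseWord S6 7 = 𝟎 ∷ 𝟏 ∷ 𝟎 ∷ 𝟎 ∷ 𝟏 ∷ 𝟎 ∷ 𝟏 ∷ 𝟏 ∷ 𝟎 ∷ 𝟏 ∷ 𝟎 ∷ 𝟎 ∷ 𝟏 ∷ 𝟏 ∷ 𝟎 ∷ 𝟎 ∷ 𝟏 ∷ 𝟎 ∷ 𝟏 ∷ 𝟏 ∷ 𝟎 ∷ 𝟎 ∷ 𝟏 ∷ 𝟏 ∷ 𝟎 ∷ 𝟏 ∷ 𝟎 ∷ 𝟎 ∷ 𝟏 ∷ 𝟏 ∷ 𝟎 ∷ 𝟎 ∷ 𝟏 ∷ 𝟎 ∷ 𝟎 ∷ []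
baseWord S6 8 = 𝟎 ∷ 𝟏 ∷ 𝟎 ∷ 𝟎 ∷ 𝟏 ∷ 𝟏 ∷ 𝟎 ∷ 𝟏 ∷ 𝟎 ∷ 𝟎 ∷ 𝟏 ∷ 𝟎 ∷ 𝟏 ∷ 𝟏 ∷ 𝟎 ∷ 𝟏 ∷ 𝟎 ∷ 𝟎 ∷ 𝟏 ∷ 𝟏 ∷ 𝟎 ∷ 𝟎 ∷ 𝟏 ∷ 𝟎 ∷ 𝟏 ∷ 𝟏 ∷ 𝟎 ∷ 𝟏 ∷ 𝟎 ∷ 𝟎 ∷ 𝟏 ∷ 𝟎 ∷ 𝟏 ∷ 𝟏 ∷ 𝟎 ∷ 𝟎 ∷ 𝟏 ∷ 𝟎 ∷ 𝟎 ∷ []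
baseWord S6 9 = 𝟎 ∷ 𝟏 ∷ 𝟎 ∷ 𝟎 ∷ 𝟏 ∷ 𝟎 ∷ 𝟏 ∷ 𝟏 ∷ 𝟎 ∷ 𝟏 ∷ 𝟎 ∷ 𝟎 ∷ 𝟏 ∷ 𝟏 ∷ 𝟎 ∷ 𝟎 ∷ 𝟏 ∷ 𝟎 ∷ 𝟏 ∷ 𝟏 ∷ 𝟎 ∷ 𝟎 ∷ 𝟏 ∷ 𝟏 ∷ 𝟎 ∷ 𝟏 ∷ 𝟎 ∷ 𝟎 ∷ 𝟏 ∷ 𝟎 ∷ 𝟏 ∷ 𝟏 ∷ 𝟎 ∷ 𝟏 ∷ 𝟎 ∷ 𝟎 ∷ 𝟏 ∷ 𝟏 ∷ 𝟎 ∷ 𝟎 ∷ 𝟏 ∷ 𝟎 ∷ 𝟎 ∷ []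
baseWord S7 1 = 𝟎 ∷ 𝟏 ∷ 𝟎 ∷ 𝟎 ∷ 𝟏 ∷ 𝟎 ∷ 𝟏 ∷ 𝟏 ∷ 𝟎 ∷ []
baseWord S7 2 = 𝟎 ∷ 𝟏 ∷ 𝟎 ∷ 𝟎 ∷ 𝟏 ∷ 𝟎 ∷ 𝟏 ∷ 𝟏 ∷ 𝟎 ∷ 𝟎 ∷ 𝟏 ∷ 𝟏 ∷ 𝟎 ∷ []
baseWord S8 2 = 𝟎 ∷ 𝟏 ∷ 𝟎 ∷ 𝟎 ∷ 𝟏 ∷ 𝟎 ∷ 𝟏 ∷ 𝟏 ∷ 𝟎 ∷ 𝟏 ∷ 𝟎 ∷ 𝟎 ∷ 𝟏 ∷ 𝟏 ∷ 𝟎 ∷ []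
baseWord S8 3 = 𝟎 ∷ 𝟏 ∷ 𝟎 ∷ 𝟎 ∷ 𝟏 ∷ 𝟎 ∷ 𝟏 ∷ 𝟏 ∷ 𝟎 ∷ 𝟎 ∷ 𝟏 ∷ 𝟏 ∷ 𝟎 ∷ 𝟏 ∷ 𝟎 ∷ 𝟎 ∷ 𝟏 ∷ 𝟏 ∷ 𝟎 ∷ []
baseWord S8 4 = 𝟎 ∷ 𝟏 ∷ 𝟎 ∷ 𝟎 ∷ 𝟏 ∷ 𝟏 ∷ 𝟎 ∷ 𝟎 ∷ 𝟏 ∷ 𝟎 ∷ 𝟏 ∷ 𝟏 ∷ 𝟎 ∷ 𝟎 ∷ 𝟏 ∷ 𝟏 ∷ 𝟎 ∷ 𝟏 ∷ 𝟎 ∷ 𝟎 ∷ 𝟏 ∷ 𝟏 ∷ 𝟎 ∷ []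
baseWord S9 0 = 𝟎 ∷ 𝟏 ∷ 𝟎 ∷ 𝟏 ∷ 𝟏 ∷ 𝟎 ∷ 𝟏 ∷ []
baseWord S9 1 = 𝟎 ∷ 𝟏 ∷ 𝟎 ∷ 𝟏 ∷ 𝟏 ∷ 𝟎 ∷ 𝟎 ∷ 𝟏 ∷ 𝟏 ∷ 𝟎 ∷ 𝟏 ∷ []
baseWord S9 2 = 𝟎 ∷ 𝟏 ∷ 𝟎 ∷ 𝟏 ∷ 𝟏 ∷ 𝟎 ∷ 𝟏 ∷ 𝟎 ∷ 𝟎 ∷ 𝟏 ∷ 𝟎 ∷ 𝟏 ∷ 𝟏 ∷ 𝟎 ∷ 𝟏 ∷ []
baseWord S9 3 = 𝟎 ∷ 𝟏 ∷ 𝟎 ∷ 𝟏 ∷ 𝟏 ∷ 𝟎 ∷ 𝟎 ∷ 𝟏 ∷ 𝟎 ∷ 𝟏 ∷ 𝟏 ∷ 𝟎 ∷ 𝟏 ∷ 𝟎 ∷ 𝟎 ∷ 𝟏 ∷ 𝟏 ∷ 𝟎 ∷ 𝟏 ∷ []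
baseWord S10 1 = 𝟎 ∷ 𝟏 ∷ 𝟏 ∷ 𝟎 ∷ 𝟏 ∷ 𝟎 ∷ 𝟎 ∷ 𝟏 ∷ 𝟎 ∷ []
baseWord S10 2 = 𝟎 ∷ 𝟏 ∷ 𝟏 ∷ 𝟎 ∷ 𝟎 ∷ 𝟏 ∷ 𝟏 ∷ 𝟎 ∷ 𝟏 ∷ 𝟎 ∷ 𝟎 ∷ 𝟏 ∷ 𝟎 ∷ []
baseWord S10 3 = 𝟎 ∷ 𝟏 ∷ 𝟏 ∷ 𝟎 ∷ 𝟎 ∷ 𝟏 ∷ 𝟏 ∷ 𝟎 ∷ 𝟏 ∷ 𝟎 ∷ 𝟎 ∷ 𝟏 ∷ 𝟏 ∷ 𝟎 ∷ 𝟎 ∷ 𝟏 ∷ 𝟎 ∷ []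
baseWord S10 4 = 𝟎 ∷ 𝟏 ∷ 𝟏 ∷ 𝟎 ∷ 𝟎 ∷ 𝟏 ∷ 𝟎 ∷ 𝟏 ∷ 𝟏 ∷ 𝟎 ∷ 𝟏 ∷ 𝟎 ∷ 𝟎 ∷ 𝟏 ∷ 𝟎 ∷ 𝟏 ∷ 𝟏 ∷ 𝟎 ∷ 𝟎 ∷ 𝟏 ∷ 𝟎 ∷ []
baseWord S10 5 = 𝟎 ∷ 𝟏 ∷ 𝟏 ∷ 𝟎 ∷ 𝟎 ∷ 𝟏 ∷ 𝟎 ∷ 𝟏 ∷ 𝟏 ∷ 𝟎 ∷ 𝟎 ∷ 𝟏 ∷ 𝟏 ∷ 𝟎 ∷ 𝟏 ∷ 𝟎 ∷ 𝟎 ∷ 𝟏 ∷ 𝟎 ∷ 𝟏 ∷ 𝟏 ∷ 𝟎 ∷ 𝟎 ∷ 𝟏 ∷ 𝟎 ∷ []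
baseWord S10 6 = 𝟎 ∷ 𝟏 ∷ 𝟏 ∷ 𝟎 ∷ 𝟎 ∷ 𝟏 ∷ 𝟏 ∷ 𝟎 ∷ 𝟏 ∷ 𝟎 ∷ 𝟎 ∷ 𝟏 ∷ 𝟎 ∷ 𝟏 ∷ 𝟏 ∷ 𝟎 ∷ 𝟎 ∷ 𝟏 ∷ 𝟏 ∷ 𝟎 ∷ 𝟏 ∷ 𝟎 ∷ 𝟎 ∷ 𝟏 ∷ 𝟏 ∷ 𝟎 ∷ 𝟎 ∷ 𝟏 ∷ 𝟎 ∷ []
baseWord S10 7 = 𝟎 ∷ 𝟏 ∷ 𝟏 ∷ 𝟎 ∷ 𝟎 ∷ 𝟏 ∷ 𝟏 ∷ 𝟎 ∷ 𝟏 ∷ 𝟎 ∷ 𝟎 ∷ 𝟏 ∷ 𝟎 ∷ 𝟏 ∷ 𝟏 ∷ 𝟎 ∷ 𝟏 ∷ 𝟎 ∷ 𝟎 ∷ 𝟏 ∷ 𝟏 ∷ 𝟎 ∷ 𝟎 ∷ 𝟏 ∷ 𝟎 ∷ 𝟏 ∷ 𝟏 ∷ 𝟎 ∷ 𝟏 ∷ 𝟎 ∷ 𝟎 ∷ 𝟏 ∷ 𝟎 ∷ []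
baseWord S10 8 = 𝟎 ∷ 𝟏 ∷ 𝟏 ∷ 𝟎 ∷ 𝟎 ∷ 𝟏 ∷ 𝟎 ∷ 𝟏 ∷ 𝟏 ∷ 𝟎 ∷ 𝟎 ∷ 𝟏 ∷ 𝟏 ∷ 𝟎 ∷ 𝟏 ∷ 𝟎 ∷ 𝟎 ∷ 𝟏 ∷ 𝟏 ∷ 𝟎 ∷ 𝟎 ∷ 𝟏 ∷ 𝟎 ∷ 𝟏 ∷ 𝟏 ∷ 𝟎 ∷ 𝟏 ∷ 𝟎 ∷ 𝟎 ∷ 𝟏 ∷ 𝟎 ∷ 𝟏 ∷ 𝟏 ∷ 𝟎 ∷ 𝟎 ∷ 𝟏 ∷ 𝟎 ∷ []
baseWord S11 5 = 𝟎 ∷ 𝟏 ∷ 𝟏 ∷ 𝟎 ∷ 𝟎 ∷ 𝟏 ∷ 𝟎 ∷ 𝟏 ∷ 𝟏 ∷ 𝟎 ∷ 𝟎 ∷ 𝟏 ∷ 𝟏 ∷ 𝟎 ∷ 𝟏 ∷ 𝟎 ∷ 𝟎 ∷ 𝟏 ∷ 𝟎 ∷ 𝟏 ∷ 𝟏 ∷ 𝟎 ∷ 𝟏 ∷ 𝟎 ∷ 𝟎 ∷ []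
baseWord S12 0 = 𝟎 ∷ 𝟏 ∷ 𝟏 ∷ 𝟎 ∷ 𝟏 ∷ 𝟎 ∷ 𝟎 ∷ []
baseWord S12 1 = 𝟎 ∷ 𝟏 ∷ 𝟏 ∷ 𝟎 ∷ 𝟎 ∷ 𝟏 ∷ 𝟏 ∷ 𝟎 ∷ 𝟏 ∷ 𝟎 ∷ 𝟎 ∷ []
baseWord S12 2 = 𝟎 ∷ 𝟏 ∷ 𝟏 ∷ 𝟎 ∷ 𝟏 ∷ 𝟎 ∷ 𝟎 ∷ 𝟏 ∷ 𝟎 ∷ 𝟏 ∷ 𝟏 ∷ 𝟎 ∷ 𝟏 ∷ 𝟎 ∷ 𝟎 ∷ []
baseWord S12 3 = 𝟎 ∷ 𝟏 ∷ 𝟏 ∷ 𝟎 ∷ 𝟎 ∷ 𝟏 ∷ 𝟏 ∷ 𝟎 ∷ 𝟏 ∷ 𝟎 ∷ 𝟎 ∷ 𝟏 ∷ 𝟎 ∷ 𝟏 ∷ 𝟏 ∷ 𝟎 ∷ 𝟏 ∷ 𝟎 ∷ 𝟎 ∷ []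
baseWord S13 1 = 𝟎 ∷ 𝟏 ∷ 𝟏 ∷ 𝟎 ∷ 𝟏 ∷ 𝟎 ∷ 𝟎 ∷ 𝟏 ∷ 𝟎 ∷ 𝟏 ∷ []
baseWord S13 2 = 𝟎 ∷ 𝟏 ∷ 𝟏 ∷ 𝟎 ∷ 𝟎 ∷ 𝟏 ∷ 𝟏 ∷ 𝟎 ∷ 𝟏 ∷ 𝟎 ∷ 𝟎 ∷ 𝟏 ∷ 𝟎 ∷ 𝟏 ∷ []
baseWord S13 3 = 𝟎 ∷ 𝟏 ∷ 𝟏 ∷ 𝟎 ∷ 𝟎 ∷ 𝟏 ∷ 𝟏 ∷ 𝟎 ∷ 𝟏 ∷ 𝟎 ∷ 𝟎 ∷ 𝟏 ∷ 𝟏 ∷ 𝟎 ∷ 𝟎 ∷ 𝟏 ∷ 𝟎 ∷ 𝟏 ∷ []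
baseWord S13 4 = 𝟎 ∷ 𝟏 ∷ 𝟏 ∷ 𝟎 ∷ 𝟎 ∷ 𝟏 ∷ 𝟎 ∷ 𝟏 ∷ 𝟏 ∷ 𝟎 ∷ 𝟏 ∷ 𝟎 ∷ 𝟎 ∷ 𝟏 ∷ 𝟎 ∷ 𝟏 ∷ 𝟏 ∷ 𝟎 ∷ 𝟎 ∷ 𝟏 ∷ 𝟎 ∷ 𝟏 ∷ []
baseWord S13 5 = 𝟎 ∷ 𝟏 ∷ 𝟏 ∷ 𝟎 ∷ 𝟎 ∷ 𝟏 ∷ 𝟎 ∷ 𝟏 ∷ 𝟏 ∷ 𝟎 ∷ 𝟎 ∷ 𝟏 ∷ 𝟏 ∷ 𝟎 ∷ 𝟏 ∷ 𝟎 ∷ 𝟎 ∷ 𝟏 ∷ 𝟎 ∷ 𝟏 ∷ 𝟏 ∷ 𝟎 ∷ 𝟎 ∷ 𝟏 ∷ 𝟎 ∷ 𝟏 ∷ []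
baseWord S13 6 = 𝟎 ∷ 𝟏 ∷ 𝟏 ∷ 𝟎 ∷ 𝟎 ∷ 𝟏 ∷ 𝟏 ∷ 𝟎 ∷ 𝟏 ∷ 𝟎 ∷ 𝟎 ∷ 𝟏 ∷ 𝟎 ∷ 𝟏 ∷ 𝟏 ∷ 𝟎 ∷ 𝟎 ∷ 𝟏 ∷ 𝟏 ∷ 𝟎 ∷ 𝟏 ∷ 𝟎 ∷ 𝟎 ∷ 𝟏 ∷ 𝟏 ∷ 𝟎 ∷ 𝟎 ∷ 𝟏 ∷ 𝟎 ∷ 𝟏 ∷ []
baseWord S13 7 = 𝟎 ∷ 𝟏 ∷ 𝟏 ∷ 𝟎 ∷ 𝟎 ∷ 𝟏 ∷ 𝟏 ∷ 𝟎 ∷ 𝟏 ∷ 𝟎 ∷ 𝟎 ∷ 𝟏 ∷ 𝟎 ∷ 𝟏 ∷ 𝟏 ∷ 𝟎 ∷ 𝟏 ∷ 𝟎 ∷ 𝟎 ∷ 𝟏 ∷ 𝟏 ∷ 𝟎 ∷ 𝟎 ∷ 𝟏 ∷ 𝟎 ∷ 𝟏 ∷ 𝟏 ∷ 𝟎 ∷ 𝟏 ∷ 𝟎 ∷ 𝟎 ∷ 𝟏 ∷ 𝟎 ∷ 𝟏 ∷ []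
baseWord S13 8 = 𝟎 ∷ 𝟏 ∷ 𝟏 ∷ 𝟎 ∷ 𝟎 ∷ 𝟏 ∷ 𝟎 ∷ 𝟏 ∷ 𝟏 ∷ 𝟎 ∷ 𝟎 ∷ 𝟏 ∷ 𝟏 ∷ 𝟎 ∷ 𝟏 ∷ 𝟎 ∷ 𝟎 ∷ 𝟏 ∷ 𝟏 ∷ 𝟎 ∷ 𝟎 ∷ 𝟏 ∷ 𝟎 ∷ 𝟏 ∷ 𝟏 ∷ 𝟎 ∷ 𝟏 ∷ 𝟎 ∷ 𝟎 ∷ 𝟏 ∷ 𝟎 ∷ 𝟏 ∷ 𝟏 ∷ 𝟎 ∷ 𝟎 ∷ 𝟏 ∷ 𝟎 ∷ 𝟏 ∷ []
baseWord S14 2 = 𝟏 ∷ 𝟎 ∷ 𝟎 ∷ 𝟏 ∷ 𝟎 ∷ 𝟏 ∷ 𝟏 ∷ 𝟎 ∷ 𝟎 ∷ 𝟏 ∷ 𝟎 ∷ 𝟎 ∷ []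
baseWord S14 3 = 𝟏 ∷ 𝟎 ∷ 𝟎 ∷ 𝟏 ∷ 𝟏 ∷ 𝟎 ∷ 𝟏 ∷ 𝟎 ∷ 𝟎 ∷ 𝟏 ∷ 𝟏 ∷ 𝟎 ∷ 𝟎 ∷ 𝟏 ∷ 𝟎 ∷ 𝟎 ∷ []
baseWord S14 4 = 𝟏 ∷ 𝟎 ∷ 𝟎 ∷ 𝟏 ∷ 𝟎 ∷ 𝟏 ∷ 𝟏 ∷ 𝟎 ∷ 𝟏 ∷ 𝟎 ∷ 𝟎 ∷ 𝟏 ∷ 𝟎 ∷ 𝟏 ∷ 𝟏 ∷ 𝟎 ∷ 𝟎 ∷ 𝟏 ∷ 𝟎 ∷ 𝟎 ∷ []
baseWord S14 5 = 𝟏 ∷ 𝟎 ∷ 𝟎 ∷ 𝟏 ∷ 𝟎 ∷ 𝟏 ∷ 𝟏 ∷ 𝟎 ∷ 𝟎 ∷ 𝟏 ∷ 𝟏 ∷ 𝟎 ∷ 𝟏 ∷ 𝟎 ∷ 𝟎 ∷ 𝟏 ∷ 𝟎 ∷ 𝟏 ∷ 𝟏 ∷ 𝟎 ∷ 𝟎 ∷ 𝟏 ∷ 𝟎 ∷ 𝟎 ∷ []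
baseWord S14 6 = 𝟏 ∷ 𝟎 ∷ 𝟎 ∷ 𝟏 ∷ 𝟏 ∷ 𝟎 ∷ 𝟎 ∷ 𝟏 ∷ 𝟎 ∷ 𝟏 ∷ 𝟏 ∷ 𝟎 ∷ 𝟎 ∷ 𝟏 ∷ 𝟏 ∷ 𝟎 ∷ 𝟏 ∷ 𝟎 ∷ 𝟎 ∷ 𝟏 ∷ 𝟎 ∷ 𝟏 ∷ 𝟏 ∷ 𝟎 ∷ 𝟎 ∷ 𝟏 ∷ 𝟎 ∷ 𝟎 ∷ []
baseWord S14 7 = 𝟏 ∷ 𝟎 ∷ 𝟎 ∷ 𝟏 ∷ 𝟎 ∷ 𝟏 ∷ 𝟏 ∷ 𝟎 ∷ 𝟏 ∷ 𝟎 ∷ 𝟎 ∷ 𝟏 ∷ 𝟏 ∷ 𝟎 ∷ 𝟎 ∷ 𝟏 ∷ 𝟎 ∷ 𝟏 ∷ 𝟏 ∷ 𝟎 ∷ 𝟏 ∷ 𝟎 ∷ 𝟎 ∷ 𝟏 ∷ 𝟎 ∷ 𝟏 ∷ 𝟏 ∷ 𝟎 ∷ 𝟎 ∷ 𝟏 ∷ 𝟎 ∷ 𝟎 ∷ []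
baseWord S15 1 = 𝟏 ∷ 𝟎 ∷ 𝟏 ∷ 𝟎 ∷ 𝟎 ∷ 𝟏 ∷ 𝟎 ∷ 𝟏 ∷ []
baseWord S15 2 = 𝟏 ∷ 𝟎 ∷ 𝟏 ∷ 𝟎 ∷ 𝟎 ∷ 𝟏 ∷ 𝟏 ∷ 𝟎 ∷ 𝟎 ∷ 𝟏 ∷ 𝟎 ∷ 𝟏 ∷ []
baseWord S15 3 = 𝟏 ∷ 𝟎 ∷ 𝟏 ∷ 𝟎 ∷ 𝟎 ∷ 𝟏 ∷ 𝟎 ∷ 𝟏 ∷ 𝟏 ∷ 𝟎 ∷ 𝟏 ∷ 𝟎 ∷ 𝟎 ∷ 𝟏 ∷ 𝟎 ∷ 𝟏 ∷ []
baseWord S15 4 = 𝟏 ∷ 𝟎 ∷ 𝟏 ∷ 𝟎 ∷ 𝟎 ∷ 𝟏 ∷ 𝟎 ∷ 𝟏 ∷ 𝟏 ∷ 𝟎 ∷ 𝟎 ∷ 𝟏 ∷ 𝟏 ∷ 𝟎 ∷ 𝟏 ∷ 𝟎 ∷ 𝟎 ∷ 𝟏 ∷ 𝟎 ∷ 𝟏 ∷ []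
baseWord S15 5 = 𝟏 ∷ 𝟎 ∷ 𝟏 ∷ 𝟎 ∷ 𝟎 ∷ 𝟏 ∷ 𝟎 ∷ 𝟏 ∷ 𝟏 ∷ 𝟎 ∷ 𝟎 ∷ 𝟏 ∷ 𝟏 ∷ 𝟎 ∷ 𝟏 ∷ 𝟎 ∷ 𝟎 ∷ 𝟏 ∷ 𝟏 ∷ 𝟎 ∷ 𝟎 ∷ 𝟏 ∷ 𝟎 ∷ 𝟏 ∷ []
baseWord S15 6 = 𝟏 ∷ 𝟎 ∷ 𝟏 ∷ 𝟎 ∷ 𝟎 ∷ 𝟏 ∷ 𝟎 ∷ 𝟏 ∷ 𝟏 ∷ 𝟎 ∷ 𝟏 ∷ 𝟎 ∷ 𝟎 ∷ 𝟏 ∷ 𝟏 ∷ 𝟎 ∷ 𝟎 ∷ 𝟏 ∷ 𝟎 ∷ 𝟏 ∷ 𝟏 ∷ 𝟎 ∷ 𝟏 ∷ 𝟎 ∷ 𝟎 ∷ 𝟏 ∷ 𝟎 ∷ 𝟏 ∷ []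
baseWord S15 7 = 𝟏 ∷ 𝟎 ∷ 𝟏 ∷ 𝟎 ∷ 𝟎 ∷ 𝟏 ∷ 𝟎 ∷ 𝟏 ∷ 𝟏 ∷ 𝟎 ∷ 𝟎 ∷ 𝟏 ∷ 𝟏 ∷ 𝟎 ∷ 𝟏 ∷ 𝟎 ∷ 𝟎 ∷ 𝟏 ∷ 𝟎 ∷ 𝟏 ∷ 𝟏 ∷ 𝟎 ∷ 𝟏 ∷ 𝟎 ∷ 𝟎 ∷ 𝟏 ∷ 𝟏 ∷ 𝟎 ∷ 𝟎 ∷ 𝟏 ∷ 𝟎 ∷ 𝟏 ∷ []
baseWord S15 8 = 𝟏 ∷ 𝟎 ∷ 𝟏 ∷ 𝟎 ∷ 𝟎 ∷ 𝟏 ∷ 𝟎 ∷ 𝟏 ∷ 𝟏 ∷ 𝟎 ∷ 𝟎 ∷ 𝟏 ∷ 𝟏 ∷ 𝟎 ∷ 𝟏 ∷ 𝟎 ∷ 𝟎 ∷ 𝟏 ∷ 𝟏 ∷ 𝟎 ∷ 𝟎 ∷ 𝟏 ∷ 𝟎 ∷ 𝟏 ∷ 𝟏 ∷ 𝟎 ∷ 𝟎 ∷ 𝟏 ∷ 𝟏 ∷ 𝟎 ∷ 𝟏 ∷ 𝟎 ∷ 𝟎 ∷ 𝟏 ∷ 𝟎 ∷ 𝟏 ∷ []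
baseWord S15 9 = 𝟏 ∷ 𝟎 ∷ 𝟏 ∷ 𝟎 ∷ 𝟎 ∷ 𝟏 ∷ 𝟎 ∷ 𝟏 ∷ 𝟏 ∷ 𝟎 ∷ 𝟎 ∷ 𝟏 ∷ 𝟏 ∷ 𝟎 ∷ 𝟏 ∷ 𝟎 ∷ 𝟎 ∷ 𝟏 ∷ 𝟎 ∷ 𝟏 ∷ 𝟏 ∷ 𝟎 ∷ 𝟏 ∷ 𝟎 ∷ 𝟎 ∷ 𝟏 ∷ 𝟏 ∷ 𝟎 ∷ 𝟎 ∷ 𝟏 ∷ 𝟎 ∷ 𝟏 ∷ 𝟏 ∷ 𝟎 ∷ 𝟏 ∷ 𝟎 ∷ 𝟎 ∷ 𝟏 ∷ 𝟎 ∷ 𝟏 ∷ []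
baseWord S15 10 = 𝟏 ∷ 𝟎 ∷ 𝟏 ∷ 𝟎 ∷ 𝟎 ∷ 𝟏 ∷ 𝟎 ∷ 𝟏 ∷ 𝟏 ∷ 𝟎 ∷ 𝟎 ∷ 𝟏 ∷ 𝟏 ∷ 𝟎 ∷ 𝟏 ∷ 𝟎 ∷ 𝟎 ∷ 𝟏 ∷ 𝟎 ∷ 𝟏 ∷ 𝟏 ∷ 𝟎 ∷ 𝟏 ∷ 𝟎 ∷ 𝟎 ∷ 𝟏 ∷ 𝟏 ∷ 𝟎 ∷ 𝟎 ∷ 𝟏 ∷ 𝟎 ∷ 𝟏 ∷ 𝟏 ∷ 𝟎 ∷ 𝟎 ∷ 𝟏 ∷ 𝟏 ∷ 𝟎 ∷ 𝟏 ∷ 𝟎 ∷ 𝟎 ∷ 𝟏 ∷ 𝟎 ∷ 𝟏 ∷ []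
baseWord S16 2 = 𝟏 ∷ 𝟏 ∷ 𝟎 ∷ 𝟏 ∷ 𝟏 ∷ 𝟎 ∷ 𝟎 ∷ 𝟏 ∷ 𝟏 ∷ 𝟎 ∷ 𝟏 ∷ 𝟎 ∷ 𝟎 ∷ 𝟏 ∷ 𝟎 ∷ []
baseWord S16 3 = 𝟏 ∷ 𝟏 ∷ 𝟎 ∷ 𝟏 ∷ 𝟏 ∷ 𝟎 ∷ 𝟎 ∷ 𝟏 ∷ 𝟏 ∷ 𝟎 ∷ 𝟏 ∷ 𝟎 ∷ 𝟎 ∷ 𝟏 ∷ 𝟏 ∷ 𝟎 ∷ 𝟎 ∷ 𝟏 ∷ 𝟎 ∷ []
baseWord S16 4 = 𝟏 ∷ 𝟏 ∷ 𝟎 ∷ 𝟏 ∷ 𝟏 ∷ 𝟎 ∷ 𝟎 ∷ 𝟏 ∷ 𝟎 ∷ 𝟏 ∷ 𝟏 ∷ 𝟎 ∷ 𝟏 ∷ 𝟎 ∷ 𝟎 ∷ 𝟏 ∷ 𝟎 ∷ 𝟏 ∷ 𝟏 ∷ 𝟎 ∷ 𝟎 ∷ 𝟏 ∷ 𝟎 ∷ []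
baseWord S16 5 = 𝟏 ∷ 𝟏 ∷ 𝟎 ∷ 𝟏 ∷ 𝟏 ∷ 𝟎 ∷ 𝟎 ∷ 𝟏 ∷ 𝟏 ∷ 𝟎 ∷ 𝟏 ∷ 𝟎 ∷ 𝟎 ∷ 𝟏 ∷ 𝟎 ∷ 𝟏 ∷ 𝟏 ∷ 𝟎 ∷ 𝟏 ∷ 𝟎 ∷ 𝟎 ∷ 𝟏 ∷ 𝟏 ∷ 𝟎 ∷ 𝟎 ∷ 𝟏 ∷ 𝟎 ∷ []
baseWord S16 6 = 𝟏 ∷ 𝟏 ∷ 𝟎 ∷ 𝟏 ∷ 𝟏 ∷ 𝟎 ∷ 𝟎 ∷ 𝟏 ∷ 𝟏 ∷ 𝟎 ∷ 𝟏 ∷ 𝟎 ∷ 𝟎 ∷ 𝟏 ∷ 𝟏 ∷ 𝟎 ∷ 𝟎 ∷ 𝟏 ∷ 𝟎 ∷ 𝟏 ∷ 𝟏 ∷ 𝟎 ∷ 𝟎 ∷ 𝟏 ∷ 𝟏 ∷ 𝟎 ∷ 𝟏 ∷ 𝟎 ∷ 𝟎 ∷ 𝟏 ∷ 𝟎 ∷ []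
baseWord S16 7 = 𝟏 ∷ 𝟏 ∷ 𝟎 ∷ 𝟏 ∷ 𝟏 ∷ 𝟎 ∷ 𝟎 ∷ 𝟏 ∷ 𝟏 ∷ 𝟎 ∷ 𝟏 ∷ 𝟎 ∷ 𝟎 ∷ 𝟏 ∷ 𝟎 ∷ 𝟏 ∷ 𝟏 ∷ 𝟎 ∷ 𝟏 ∷ 𝟎 ∷ 𝟎 ∷ 𝟏 ∷ 𝟏 ∷ 𝟎 ∷ 𝟎 ∷ 𝟏 ∷ 𝟎 ∷ 𝟏 ∷ 𝟏 ∷ 𝟎 ∷ 𝟏 ∷ 𝟎 ∷ 𝟎 ∷ 𝟏 ∷ 𝟎 ∷ []
baseWord S16 8 = 𝟏 ∷ 𝟏 ∷ 𝟎 ∷ 𝟏 ∷ 𝟏 ∷ 𝟎 ∷ 𝟎 ∷ 𝟏 ∷ 𝟎 ∷ 𝟏 ∷ 𝟏 ∷ 𝟎 ∷ 𝟏 ∷ 𝟎 ∷ 𝟎 ∷ 𝟏 ∷ 𝟏 ∷ 𝟎 ∷ 𝟎 ∷ 𝟏 ∷ 𝟎 ∷ 𝟏 ∷ 𝟏 ∷ 𝟎 ∷ 𝟎 ∷ 𝟏 ∷ 𝟏 ∷ 𝟎 ∷ 𝟏 ∷ 𝟎 ∷ 𝟎 ∷ 𝟏 ∷ 𝟎 ∷ 𝟏 ∷ 𝟏 ∷ 𝟎 ∷ 𝟎 ∷ 𝟏 ∷ 𝟎 ∷ []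
baseWord S17 10 = 𝟏 ∷ 𝟏 ∷ 𝟎 ∷ 𝟏 ∷ 𝟎 ∷ 𝟎 ∷ 𝟏 ∷ 𝟎 ∷ 𝟏 ∷ 𝟏 ∷ 𝟎 ∷ 𝟏 ∷ 𝟎 ∷ 𝟎 ∷ 𝟏 ∷ 𝟏 ∷ 𝟎 ∷ 𝟎 ∷ 𝟏 ∷ 𝟎 ∷ 𝟏 ∷ 𝟏 ∷ 𝟎 ∷ 𝟎 ∷ 𝟏 ∷ 𝟏 ∷ 𝟎 ∷ 𝟏 ∷ 𝟎 ∷ 𝟎 ∷ 𝟏 ∷ 𝟎 ∷ 𝟏 ∷ 𝟏 ∷ 𝟎 ∷ 𝟏 ∷ 𝟎 ∷ 𝟎 ∷ 𝟏 ∷ 𝟏 ∷ 𝟎 ∷ 𝟎 ∷ 𝟏 ∷ 𝟎 ∷ 𝟎 ∷ []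
baseWord S18 2 = 𝟏 ∷ 𝟏 ∷ 𝟎 ∷ 𝟏 ∷ 𝟎 ∷ 𝟎 ∷ 𝟏 ∷ 𝟎 ∷ 𝟏 ∷ 𝟏 ∷ 𝟎 ∷ 𝟏 ∷ 𝟎 ∷ []
baseWord S18 3 = 𝟏 ∷ 𝟏 ∷ 𝟎 ∷ 𝟏 ∷ 𝟎 ∷ 𝟎 ∷ 𝟏 ∷ 𝟎 ∷ 𝟏 ∷ 𝟏 ∷ 𝟎 ∷ 𝟎 ∷ 𝟏 ∷ 𝟏 ∷ 𝟎 ∷ 𝟏 ∷ 𝟎 ∷ []
baseWord _ _ = []

open Spec

inner : State → ℕ → ℕ
inner s q = 4 * q + residue (specOf s)

-- With q = h + h + u, the lengths match and, as soon as q ≥ firstRule s, the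
-- parent index h + offset lies between firstBase of the parent and q.
RuleValid : State → Rule → ℕ → Set
RuleValid s (rule p op a b v) u =
  childBorder op a b (border (specOf p)) ≡ border (specOf s) × Admissible op (border (specOf p))
  × a ≤ 3 × b ≤ 3
  × 4 * u + residue (specOf s) + a + b ≡ 8 * v + 2 * residue (specOf p) + 4
  × firstBase (specOf p) + firstBase (specOf p) + u ≤ firstRule (specOf s) + v + v
  × v + v + 2 ≤ firstRule (specOf s) + u

BaseValid : State → Set
BaseValid s = ∀ {q} → q < firstRule (specOf s) → firstBase (specOf s) ≤ q
            → Realizes (at (baseWord s q)) (inner s q) (border (specOf s))

StateValid : State → Set
StateValid s = ruleOffset S ≤ firstRule S × RuleValid s (evenRule S) (ruleOffset S)
             × RuleValid s (oddRule S) (suc (ruleOffset S)) × BaseValid s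
  where S = specOf s

ruleValid? : ∀ s R u → Dec (RuleValid s R u)
ruleValid? s (rule p op a b v) u =
  ×-≡-dec _≟w_ _≟w_ (childBorder op a b (border (specOf p))) (border (specOf s))
  ×-dec admissible? op (border (specOf p))
  ×-dec a ≤? 3 ×-dec b ≤? 3 ×-dec _ ≟ _ ×-dec _ ≤? _ ×-dec _ ≤? _

stateValid? : ∀ s → Dec (StateValid s)
stateValid? s = ruleOffset S ≤? firstRule S ×-dec ruleValid? s (evenRule S) (ruleOffset S)
  ×-dec ruleValid? s (oddRule S) (suc (ruleOffset S))
  ×-dec allUpTo? (λ q → firstBase S ≤? q →-dec realizes? (at (baseWord s q)) (inner s q) (border S))
                 (firstRule S)
  where S = specOf s

-- Opaque: unfolding these computed proofs during later type checking is
-- prohibitively expensive.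
opaque
  certificate : ∀ s → StateValid s
  certificate s = toWitness (checked s)
    where
    checked : ∀ s → True (stateValid? s)
    checked S0 = tt
    checked S1 = tt
    checked S2 = tt
    checked S3 = tt
    checked S4 = tt
    checked S5 = tt
    checked S6 = tt
    checked S7 = tt
    checked S8 = tt
    checked S9 = tt
    checked S10 = tt
    checked S11 = tt
    checked S12 = tt
    checked S13 = tt
    checked S14 = tt
    checked S15 = tt
    checked S16 = tt
    checked S17 = tt
    checked S18 = tt

Realizable : State → ℕ → Set
Realizable s q = ∃[ g ] Realizes g (inner s q) (border (specOf s))

apply-rule : ∀ {s q h u} R → RuleValid s R u → q ≡ h + h + u → firstRule (specOf s) ≤ q
           → (∀ {q′} → q′ < q → ∀ s′ → firstBase (specOf s′) ≤ q′ → Realizable s′ q′) → Realizable s q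
apply-rule {s} {q} {h} {u} (rule p op a b v)
           (border≡ , admissible , a≤3 , b≤3 , length≡ , low , high) refl qb≤q rec =
  let g , r = rec (parent-smaller {h = h} {u} {v} qb≤q high) p (parent-large {h = h} {u} {v} qb≤q low)
      K = inner p (h + v)
  in shift a (apply op K g) ,
     subst (Realizes (shift a (apply op K g)) (inner s q)) border≡
           (realizes-child op {g} {K} {border (specOf p)} {a} {b} {inner s q} r admissible a≤3 b≤3
                           (rule-length {u} {residue (specOf s)} {a} {b} h length≡))

realizable : ∀ q s → firstBase (specOf s) ≤ q → Realizable s q
realizable = <-rec _ realizable-step
  where
  realizable-step : ∀ q → (∀ {q′} → q′ < q → ∀ s → firstBase (specOf s) ≤ q′ → Realizable s q′)
                  → ∀ s → firstBase (specOf s) ≤ q → Realizable s q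
  realizable-step q rec s q₀≤q with certificate s | q <? firstRule (specOf s)
  ... | _ , _ , _ , base | yes q<qb = at (baseWord s q) , base q<qb q₀≤q
  ... | offset≤qb , even-valid , odd-valid , _ | no q≮qb with halve (≤-trans offset≤qb (≮⇒≥ q≮qb))
  ...   | h , inj₁ q≡ = apply-rule {s} {q} {h} (evenRule (specOf s)) even-valid q≡ (≮⇒≥ q≮qb) rec
  ...   | h , inj₂ q≡ = apply-rule {s} {q} {h} (oddRule (specOf s)) odd-valid q≡ (≮⇒≥ q≮qb) rec

EarmarkedBorder : Border → Set
EarmarkedBorder (u , v) = (u ≡ 𝟎 ∷ 𝟎 ∷ 𝟏 ∷ 𝟎 ∷ [] ⊎ u ≡ 𝟏 ∷ 𝟏 ∷ 𝟎 ∷ 𝟏 ∷ []) × v ≡ 𝟎 ∷ 𝟏 ∷ 𝟎 ∷ 𝟎 ∷ []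

earmarkedBorder? : ∀ β → Dec (EarmarkedBorder β)
earmarkedBorder? (u , v) = (u ≟w (𝟎 ∷ 𝟎 ∷ 𝟏 ∷ 𝟎 ∷ []) ⊎-dec u ≟w (𝟏 ∷ 𝟏 ∷ 𝟎 ∷ 𝟏 ∷ [])) ×-dec v ≟w (𝟎 ∷ 𝟏 ∷ 𝟎 ∷ 𝟎 ∷ [])

EarmarkedOfLength : ℕ → Set
EarmarkedOfLength n = ∃[ w ] (length w ≡ n × Earmarked w)

earmarked-applyUpTo : ∀ {g L β} → Realizes g L β → EarmarkedBorder β → Earmarked (applyUpTo g (4 + L))
earmarked-applyUpTo {g} {L} (free , refl , refl) (prefix , suffix) =
  overlapFree-applyUpTo {g} free , prefix , trans (suffix4-applyUpTo g L) suffix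

earmarked-state : ∀ s q → firstBase (specOf s) ≤ q → EarmarkedBorder (border (specOf s))
                → EarmarkedOfLength (4 + inner s q)
earmarked-state s q q₀≤q earmarked with realizable q s q₀≤q
... | g , r = applyUpTo g (4 + inner s q) , length-applyUpTo g _ , earmarked-applyUpTo {g} r earmarked

length-decomposition : ∀ r q → 4 + (4 * q + r) ≡ r + suc q * 4
length-decomposition = solve-∀

earmarked-large : ∀ r Q → r ≢ 0 → r < 4 → 11 ≤ Q → EarmarkedOfLength (r + Q * 4)
earmarked-large 0 _ r≢0 _ _ = contradiction refl r≢0
earmarked-large 1 (suc q) _ _ (s≤s 10≤q) =
  subst EarmarkedOfLength (length-decomposition 1 q) (earmarked-state S17 q 10≤q (inj₂ refl , refl))
earmarked-large 2 (suc q) _ _ (s≤s 10≤q) =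
  subst EarmarkedOfLength (length-decomposition 2 q)
        (earmarked-state S0 q (≤-trans (m≤m+n 4 6) 10≤q) (inj₁ refl , refl))
earmarked-large 3 (suc q) _ _ (s≤s 10≤q) =
  subst EarmarkedOfLength (length-decomposition 3 q)
        (earmarked-state S1 q (≤-trans (m≤m+n 6 4) 10≤q) (inj₁ refl , refl))
earmarked-large (suc (suc (suc (suc _)))) _ _ (s≤s (s≤s (s≤s (s≤s ())))) _

smallWords : List Word
smallWords =
  (𝟎 ∷ 𝟎 ∷ 𝟏 ∷ 𝟎 ∷ 𝟏 ∷ 𝟏 ∷ 𝟎 ∷ 𝟏 ∷ 𝟎 ∷ 𝟎 ∷ []) ∷
  (𝟎 ∷ 𝟎 ∷ 𝟏 ∷ 𝟎 ∷ 𝟎 ∷ 𝟏 ∷ 𝟏 ∷ 𝟎 ∷ 𝟏 ∷ 𝟎 ∷ 𝟎 ∷ []) ∷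
  (𝟏 ∷ 𝟏 ∷ 𝟎 ∷ 𝟏 ∷ 𝟎 ∷ 𝟎 ∷ 𝟏 ∷ 𝟏 ∷ 𝟎 ∷ 𝟎 ∷ 𝟏 ∷ 𝟎 ∷ 𝟎 ∷ []) ∷
  (𝟎 ∷ 𝟎 ∷ 𝟏 ∷ 𝟎 ∷ 𝟏 ∷ 𝟏 ∷ 𝟎 ∷ 𝟎 ∷ 𝟏 ∷ 𝟏 ∷ 𝟎 ∷ 𝟏 ∷ 𝟎 ∷ 𝟎 ∷ []) ∷
  (𝟏 ∷ 𝟏 ∷ 𝟎 ∷ 𝟏 ∷ 𝟎 ∷ 𝟎 ∷ 𝟏 ∷ 𝟎 ∷ 𝟏 ∷ 𝟏 ∷ 𝟎 ∷ 𝟎 ∷ 𝟏 ∷ 𝟎 ∷ 𝟎 ∷ []) ∷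
  (𝟎 ∷ 𝟎 ∷ 𝟏 ∷ 𝟎 ∷ 𝟎 ∷ 𝟏 ∷ 𝟏 ∷ 𝟎 ∷ 𝟎 ∷ 𝟏 ∷ 𝟎 ∷ 𝟏 ∷ 𝟏 ∷ 𝟎 ∷ 𝟏 ∷ 𝟎 ∷ 𝟎 ∷ []) ∷
  (𝟏 ∷ 𝟏 ∷ 𝟎 ∷ 𝟏 ∷ 𝟎 ∷ 𝟎 ∷ 𝟏 ∷ 𝟎 ∷ 𝟏 ∷ 𝟏 ∷ 𝟎 ∷ 𝟎 ∷ 𝟏 ∷ 𝟏 ∷ 𝟎 ∷ 𝟏 ∷ 𝟎 ∷ 𝟎 ∷ []) ∷
  (𝟎 ∷ 𝟎 ∷ 𝟏 ∷ 𝟎 ∷ 𝟎 ∷ 𝟏 ∷ 𝟏 ∷ 𝟎 ∷ 𝟏 ∷ 𝟎 ∷ 𝟎 ∷ 𝟏 ∷ 𝟎 ∷ 𝟏 ∷ 𝟏 ∷ 𝟎 ∷ 𝟏 ∷ 𝟎 ∷ 𝟎 ∷ []) ∷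
  (𝟎 ∷ 𝟎 ∷ 𝟏 ∷ 𝟎 ∷ 𝟎 ∷ 𝟏 ∷ 𝟏 ∷ 𝟎 ∷ 𝟎 ∷ 𝟏 ∷ 𝟎 ∷ 𝟏 ∷ 𝟏 ∷ 𝟎 ∷ 𝟎 ∷ 𝟏 ∷ 𝟏 ∷ 𝟎 ∷ 𝟏 ∷ 𝟎 ∷ 𝟎 ∷ []) ∷
  (𝟎 ∷ 𝟎 ∷ 𝟏 ∷ 𝟎 ∷ 𝟏 ∷ 𝟏 ∷ 𝟎 ∷ 𝟎 ∷ 𝟏 ∷ 𝟏 ∷ 𝟎 ∷ 𝟏 ∷ 𝟎 ∷ 𝟎 ∷ 𝟏 ∷ 𝟎 ∷ 𝟏 ∷ 𝟏 ∷ 𝟎 ∷ 𝟏 ∷ 𝟎 ∷ 𝟎 ∷ []) ∷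
  (𝟎 ∷ 𝟎 ∷ 𝟏 ∷ 𝟎 ∷ 𝟎 ∷ 𝟏 ∷ 𝟏 ∷ 𝟎 ∷ 𝟏 ∷ 𝟎 ∷ 𝟎 ∷ 𝟏 ∷ 𝟎 ∷ 𝟏 ∷ 𝟏 ∷ 𝟎 ∷ 𝟎 ∷ 𝟏 ∷ 𝟏 ∷ 𝟎 ∷ 𝟏 ∷ 𝟎 ∷ 𝟎 ∷ []) ∷
  (𝟏 ∷ 𝟏 ∷ 𝟎 ∷ 𝟏 ∷ 𝟎 ∷ 𝟎 ∷ 𝟏 ∷ 𝟎 ∷ 𝟏 ∷ 𝟏 ∷ 𝟎 ∷ 𝟎 ∷ 𝟏 ∷ 𝟏 ∷ 𝟎 ∷ 𝟏 ∷ 𝟎 ∷ 𝟎 ∷ 𝟏 ∷ 𝟏 ∷ 𝟎 ∷ 𝟎 ∷ 𝟏 ∷ 𝟎 ∷ 𝟎 ∷ []) ∷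
  (𝟎 ∷ 𝟎 ∷ 𝟏 ∷ 𝟎 ∷ 𝟎 ∷ 𝟏 ∷ 𝟏 ∷ 𝟎 ∷ 𝟎 ∷ 𝟏 ∷ 𝟎 ∷ 𝟏 ∷ 𝟏 ∷ 𝟎 ∷ 𝟏 ∷ 𝟎 ∷ 𝟎 ∷ 𝟏 ∷ 𝟎 ∷ 𝟏 ∷ 𝟏 ∷ 𝟎 ∷ 𝟎 ∷ 𝟏 ∷ 𝟎 ∷ 𝟎 ∷ []) ∷
  (𝟏 ∷ 𝟏 ∷ 𝟎 ∷ 𝟏 ∷ 𝟎 ∷ 𝟎 ∷ 𝟏 ∷ 𝟏 ∷ 𝟎 ∷ 𝟎 ∷ 𝟏 ∷ 𝟎 ∷ 𝟏 ∷ 𝟏 ∷ 𝟎 ∷ 𝟏 ∷ 𝟎 ∷ 𝟎 ∷ 𝟏 ∷ 𝟎 ∷ 𝟏 ∷ 𝟏 ∷ 𝟎 ∷ 𝟎 ∷ 𝟏 ∷ 𝟎 ∷ 𝟎 ∷ []) ∷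
  (𝟎 ∷ 𝟎 ∷ 𝟏 ∷ 𝟎 ∷ 𝟎 ∷ 𝟏 ∷ 𝟏 ∷ 𝟎 ∷ 𝟎 ∷ 𝟏 ∷ 𝟎 ∷ 𝟏 ∷ 𝟏 ∷ 𝟎 ∷ 𝟎 ∷ 𝟏 ∷ 𝟏 ∷ 𝟎 ∷ 𝟏 ∷ 𝟎 ∷ 𝟎 ∷ 𝟏 ∷ 𝟎 ∷ 𝟏 ∷ 𝟏 ∷ 𝟎 ∷ 𝟏 ∷ 𝟎 ∷ 𝟎 ∷ []) ∷
  (𝟎 ∷ 𝟎 ∷ 𝟏 ∷ 𝟎 ∷ 𝟎 ∷ 𝟏 ∷ 𝟏 ∷ 𝟎 ∷ 𝟎 ∷ 𝟏 ∷ 𝟎 ∷ 𝟏 ∷ 𝟏 ∷ 𝟎 ∷ 𝟎 ∷ 𝟏 ∷ 𝟏 ∷ 𝟎 ∷ 𝟏 ∷ 𝟎 ∷ 𝟎 ∷ 𝟏 ∷ 𝟎 ∷ 𝟏 ∷ 𝟏 ∷ 𝟎 ∷ 𝟎 ∷ 𝟏 ∷ 𝟎 ∷ 𝟎 ∷ []) ∷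
  (𝟎 ∷ 𝟎 ∷ 𝟏 ∷ 𝟎 ∷ 𝟎 ∷ 𝟏 ∷ 𝟏 ∷ 𝟎 ∷ 𝟏 ∷ 𝟎 ∷ 𝟎 ∷ 𝟏 ∷ 𝟎 ∷ 𝟏 ∷ 𝟏 ∷ 𝟎 ∷ 𝟏 ∷ 𝟎 ∷ 𝟎 ∷ 𝟏 ∷ 𝟏 ∷ 𝟎 ∷ 𝟎 ∷ 𝟏 ∷ 𝟎 ∷ 𝟏 ∷ 𝟏 ∷ 𝟎 ∷ 𝟏 ∷ 𝟎 ∷ 𝟎 ∷ []) ∷
  (𝟎 ∷ 𝟎 ∷ 𝟏 ∷ 𝟎 ∷ 𝟎 ∷ 𝟏 ∷ 𝟏 ∷ 𝟎 ∷ 𝟎 ∷ 𝟏 ∷ 𝟎 ∷ 𝟏 ∷ 𝟏 ∷ 𝟎 ∷ 𝟎 ∷ 𝟏 ∷ 𝟏 ∷ 𝟎 ∷ 𝟏 ∷ 𝟎 ∷ 𝟎 ∷ 𝟏 ∷ 𝟏 ∷ 𝟎 ∷ 𝟎 ∷ 𝟏 ∷ 𝟎 ∷ 𝟏 ∷ 𝟏 ∷ 𝟎 ∷ 𝟏 ∷ 𝟎 ∷ 𝟎 ∷ []) ∷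
  (𝟎 ∷ 𝟎 ∷ 𝟏 ∷ 𝟎 ∷ 𝟏 ∷ 𝟏 ∷ 𝟎 ∷ 𝟎 ∷ 𝟏 ∷ 𝟏 ∷ 𝟎 ∷ 𝟏 ∷ 𝟎 ∷ 𝟎 ∷ 𝟏 ∷ 𝟎 ∷ 𝟏 ∷ 𝟏 ∷ 𝟎 ∷ 𝟏 ∷ 𝟎 ∷ 𝟎 ∷ 𝟏 ∷ 𝟏 ∷ 𝟎 ∷ 𝟎 ∷ 𝟏 ∷ 𝟎 ∷ 𝟏 ∷ 𝟏 ∷ 𝟎 ∷ 𝟏 ∷ 𝟎 ∷ 𝟎 ∷ []) ∷
  (𝟎 ∷ 𝟎 ∷ 𝟏 ∷ 𝟎 ∷ 𝟎 ∷ 𝟏 ∷ 𝟏 ∷ 𝟎 ∷ 𝟏 ∷ 𝟎 ∷ 𝟎 ∷ 𝟏 ∷ 𝟎 ∷ 𝟏 ∷ 𝟏 ∷ 𝟎 ∷ 𝟎 ∷ 𝟏 ∷ 𝟏 ∷ 𝟎 ∷ 𝟏 ∷ 𝟎 ∷ 𝟎 ∷ 𝟏 ∷ 𝟏 ∷ 𝟎 ∷ 𝟎 ∷ 𝟏 ∷ 𝟎 ∷ 𝟏 ∷ 𝟏 ∷ 𝟎 ∷ 𝟏 ∷ 𝟎 ∷ 𝟎 ∷ []) ∷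
  (𝟎 ∷ 𝟎 ∷ 𝟏 ∷ 𝟎 ∷ 𝟎 ∷ 𝟏 ∷ 𝟏 ∷ 𝟎 ∷ 𝟎 ∷ 𝟏 ∷ 𝟎 ∷ 𝟏 ∷ 𝟏 ∷ 𝟎 ∷ 𝟏 ∷ 𝟎 ∷ 𝟎 ∷ 𝟏 ∷ 𝟎 ∷ 𝟏 ∷ 𝟏 ∷ 𝟎 ∷ 𝟎 ∷ 𝟏 ∷ 𝟏 ∷ 𝟎 ∷ 𝟏 ∷ 𝟎 ∷ 𝟎 ∷ 𝟏 ∷ 𝟎 ∷ 𝟏 ∷ 𝟏 ∷ 𝟎 ∷ 𝟏 ∷ 𝟎 ∷ 𝟎 ∷ []) ∷
  (𝟎 ∷ 𝟎 ∷ 𝟏 ∷ 𝟎 ∷ 𝟏 ∷ 𝟏 ∷ 𝟎 ∷ 𝟎 ∷ 𝟏 ∷ 𝟏 ∷ 𝟎 ∷ 𝟏 ∷ 𝟎 ∷ 𝟎 ∷ 𝟏 ∷ 𝟎 ∷ 𝟏 ∷ 𝟏 ∷ 𝟎 ∷ 𝟏 ∷ 𝟎 ∷ 𝟎 ∷ 𝟏 ∷ 𝟏 ∷ 𝟎 ∷ 𝟎 ∷ 𝟏 ∷ 𝟎 ∷ 𝟏 ∷ 𝟏 ∷ 𝟎 ∷ 𝟎 ∷ 𝟏 ∷ 𝟏 ∷ 𝟎 ∷ 𝟏 ∷ 𝟎 ∷ 𝟎 ∷ []) ∷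
  (𝟎 ∷ 𝟎 ∷ 𝟏 ∷ 𝟎 ∷ 𝟎 ∷ 𝟏 ∷ 𝟏 ∷ 𝟎 ∷ 𝟏 ∷ 𝟎 ∷ 𝟎 ∷ 𝟏 ∷ 𝟎 ∷ 𝟏 ∷ 𝟏 ∷ 𝟎 ∷ 𝟎 ∷ 𝟏 ∷ 𝟏 ∷ 𝟎 ∷ 𝟏 ∷ 𝟎 ∷ 𝟎 ∷ 𝟏 ∷ 𝟏 ∷ 𝟎 ∷ 𝟎 ∷ 𝟏 ∷ 𝟎 ∷ 𝟏 ∷ 𝟏 ∷ 𝟎 ∷ 𝟎 ∷ 𝟏 ∷ 𝟏 ∷ 𝟎 ∷ 𝟏 ∷ 𝟎 ∷ 𝟎 ∷ []) ∷
  (𝟎 ∷ 𝟎 ∷ 𝟏 ∷ 𝟎 ∷ 𝟎 ∷ 𝟏 ∷ 𝟏 ∷ 𝟎 ∷ 𝟎 ∷ 𝟏 ∷ 𝟎 ∷ 𝟏 ∷ 𝟏 ∷ 𝟎 ∷ 𝟎 ∷ 𝟏 ∷ 𝟏 ∷ 𝟎 ∷ 𝟏 ∷ 𝟎 ∷ 𝟎 ∷ 𝟏 ∷ 𝟎 ∷ 𝟏 ∷ 𝟏 ∷ 𝟎 ∷ 𝟏 ∷ 𝟎 ∷ 𝟎 ∷ 𝟏 ∷ 𝟏 ∷ 𝟎 ∷ 𝟎 ∷ 𝟏 ∷ 𝟎 ∷ 𝟏 ∷ 𝟏 ∷ 𝟎 ∷ 𝟏 ∷ 𝟎 ∷ 𝟎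 ∷ []) ∷
  (𝟎 ∷ 𝟎 ∷ 𝟏 ∷ 𝟎 ∷ 𝟎 ∷ 𝟏 ∷ 𝟏 ∷ 𝟎 ∷ 𝟎 ∷ 𝟏 ∷ 𝟎 ∷ 𝟏 ∷ 𝟏 ∷ 𝟎 ∷ 𝟎 ∷ 𝟏 ∷ 𝟏 ∷ 𝟎 ∷ 𝟏 ∷ 𝟎 ∷ 𝟎 ∷ 𝟏 ∷ 𝟏 ∷ 𝟎 ∷ 𝟎 ∷ 𝟏 ∷ 𝟎 ∷ 𝟏 ∷ 𝟏 ∷ 𝟎 ∷ 𝟏 ∷ 𝟎 ∷ 𝟎 ∷ 𝟏 ∷ 𝟎 ∷ 𝟏 ∷ 𝟏 ∷ 𝟎 ∷ 𝟎 ∷ 𝟏 ∷ 𝟎 ∷ 𝟎 ∷ []) ∷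
  (𝟎 ∷ 𝟎 ∷ 𝟏 ∷ 𝟎 ∷ 𝟎 ∷ 𝟏 ∷ 𝟏 ∷ 𝟎 ∷ 𝟏 ∷ 𝟎 ∷ 𝟎 ∷ 𝟏 ∷ 𝟎 ∷ 𝟏 ∷ 𝟏 ∷ 𝟎 ∷ 𝟏 ∷ 𝟎 ∷ 𝟎 ∷ 𝟏 ∷ 𝟏 ∷ 𝟎 ∷ 𝟎 ∷ 𝟏 ∷ 𝟎 ∷ 𝟏 ∷ 𝟏 ∷ 𝟎 ∷ 𝟎 ∷ 𝟏 ∷ 𝟏 ∷ 𝟎 ∷ 𝟏 ∷ 𝟎 ∷ 𝟎 ∷ 𝟏 ∷ 𝟎 ∷ 𝟏 ∷ 𝟏 ∷ 𝟎 ∷ 𝟏 ∷ 𝟎 ∷ 𝟎 ∷ []) ∷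
  []

Certified : ℕ → Word → Set
Certified n w = length w ≡ n × OverlapFreeBelow (at w) n × EarmarkedBorder (prefix4 w , suffix4 w)

opaque
  smallCovered : ∀ {n} → n < 45 → 10 ≤ n → n % 4 ≢ 0 → Any (Certified n) smallWords
  smallCovered = toWitness {a? = allUpTo? covered? 45} tt
    where
    certified? : ∀ n w → Dec (Certified n w)
    certified? n w =
      length w ≟ n ×-dec overlapFreeBelow? (at w) n ×-dec earmarkedBorder? (prefix4 w , suffix4 w)
    covered? : ∀ n → Dec (10 ≤ n → n % 4 ≢ 0 → Any (Certified n) smallWords)
    covered? n = 10 ≤? n →-dec (¬? (n % 4 ≟ 0) →-dec any? (certified? n) smallWords)

certified-earmarked : ∀ {n w} → Certified n w → EarmarkedOfLength n
certified-earmarked {w = w} (length≡ , free , prefix , suffix) =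
  w , length≡ , overlapFree-at (subst (OverlapFreeBelow (at w)) (sym length≡) free) , prefix , suffix

earmarked-small : ∀ {n} → n < 45 → 10 ≤ n → n % 4 ≢ 0 → EarmarkedOfLength n
earmarked-small n<45 10≤n n%4≢0 =
  certified-earmarked (proj₂ (satisfied (smallCovered n<45 10≤n n%4≢0)))

lemma2p4 : (n : ℕ) → n ≥ 10 → ¬ (n % 4 ≡ 0)
    → ∃[ w ] (length w ≡ n × Earmarked w)
lemma2p4 n n≥10 n%4≢0 with n <? 45
... | yes n<45 = earmarked-small n<45 n≥10 n%4≢0
... | no n≮45 =
  subst EarmarkedOfLength (sym (m≡m%n+[m/n]*n n 4))
        (earmarked-large (n % 4) (n / 4) n%4≢0 (m%n<n n 4) (/-monoˡ-≤ 4 (≮⇒≥ n≮45)))
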